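{- Let $n\ge2$ and $x,y,z,x',y',z'\in C_n$. Then $xyz\ \ddot{\sim}\ x'y'z'$ if and only if $xyz=x'y'z'$ or $xyz,x'y'z'\in\{a1\bar1,\ 1a\bar1,\ 1\bar1a\}$ for some $a\in C_n$.
   Context: Let $n\ge2$ and $C_n=\{1<2<\cdots<n<\bar n<\overline{n-1}<\cdots<\bar 1\}$; $C_n^*$ is the free monoid of words over $C_n$ and $|w|_a$ the number of occurrences of the letter $a$ in $w$. Convention: the symbols $n+1$ and $\overline{n+1}$ never occur in any word. For $i\in\{1,\dots,n\}$, $w$ has an $i$-inversion if $w=w_1xw_2yw_3$ with $x\in\{i,\overline{i+1}\}$, $y\in\{i+1,\bar i\}$. Quasi-crystal structure on $C_n^*$: $\mathrm{wt}(w)=(|w|_1-|w|_{\bar1},\dots,|w|_n-|w|_{\bar n})\in\mathbb{Z}^n$. For $i\in\{1,\dots,n\}$: if $w$ has an $i$-inversion then $\ddot{\varepsilon}_i(w)=\ddot{\varphi}_i(w)=+\infty$ and $\ddot{e}_i(w),\ddot{f}_i(w)$ are undefined; otherwise $\ddot{\varepsilon}_i(w)=|w|_{i+1}+|w|_{\bar i}$, $\ddot{\varphi}_i(w)=|w|_i+|w|_{\overline{i+1}}$; $\ddot{e}_i(w)$ is defined iff $\ddot{\varepsilon}_i(w)>0$ and is obtained by replacing the right-most letter of $w$ lying in $\{i+1,\bar i\}$ by its image ($i+1\mapsto i$, $\bar i\mapsto\overline{i+1}$ for $i<n$; $\bar n\mapsto n$ for $i=n$); $\ddot{f}_i(w)$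 is defined iff $\ddot{\varphi}_i(w)>0$ and is obtained by replacing the left-most letter of $w$ lying in $\{i,\overline{i+1}\}$ by its image ($i\mapsto i+1$, $\overline{i+1}\mapsto\bar i$ for $i<n$; $n\mapsto\bar n$ for $i=n$). The connected component $C_n^*(w)$ is the set of words obtained from $w$ by finitely many (defined) applications of the operators $\ddot{e}_i,\ddot{f}_i$. Hypoplactic congruence: $u\ddot{\sim}v$ iff there is a bijection $\psi:C_n^*(u)\to C_n^*(v)$ with $\psi(u)=v$ such that for all $x\in C_n^*(u)$ and $i$: $\psi(x)$ has the same $\mathrm{wt},\ddot{\varepsilon}_i,\ddot{\varphi}_i$ as $x$, $\ddot{e}_i(\psi(x))$ is defined iff $\ddot{e}_i(x)$ is (and then $\psi(\ddot{e}_i(x))=\ddot{e}_i(\psi(x))$), and likewise for $\ddot{f}_i$. -}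

module Defs where

open import Data.Nat using (ℕ; zero; suc; _≤_; s≤s; z≤n)
open import Data.Integer using (ℤ; +_; _-_)
open import Data.Fin using (Fin; zero; suc; _≟_)
open import Data.Bool using (Bool; true; false; if_then_else_; _∧_; _∨_)
open import Data.Maybe using (Maybe; just; nothing)
import Data.Maybe as Maybe
open import Data.List using (List; []; _∷_; reverse)
open import Data.Vec using (Vec; tabulate)
open import Data.Product using (Σ; Σ-syntax; ∃; _×_; _,_; proj₁; proj₂)
open import Function.Bundles using (_⇔_)
open import Relation.Nullary.Decidable using (⌊_⌋)
open import Relation.Binary.PropositionalEquality using (_≡_)

-- The alphabet C_n: num i is the letter i+1, bar i is the letter \overline{i+1}
-- (indices are 0-based Fin n).
data Letter (n : ℕ) : Set where
  num : Fin n → Letter n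
  bar : Fin n → Letter n

Word : ℕ → Set
Word n = List (Letter n)

next : ∀ {n} → Fin n → Maybe (Fin n)
next {suc zero} zero = nothing
next {suc (suc n)} zero = just (suc zero)
next {suc (suc n)} (suc i) = Maybe.map suc (next i)

-- letters in {i, \overline{i+1}}  (the symbol \overline{n+1} does not exist)
isX : ∀ {n} → Fin n → Letter n → Bool
isX i (num j) = ⌊ j ≟ i ⌋
isX i (bar j) with next i
... | just k = ⌊ j ≟ k ⌋
... | nothing = false

-- letters in {i+1, \bar i}  (the symbol n+1 does not exist)
isY : ∀ {n} → Fin n → Letter n → Bool
isY i (num j) with next i
... | just k = ⌊ j ≟ k ⌋
... | nothing = false
isY i (bar j) = ⌊ j ≟ i ⌋

eImg : ∀ {n} → Fin n → Letter n → Letter n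
eImg i (num j) = num i
eImg i (bar j) with next i
... | just k = bar k
... | nothing = num i

fImg : ∀ {n} → Fin n → Letter n → Letter n
fImg i (num j) with next i
... | just k = num k
... | nothing = bar i
fImg i (bar j) = bar i

count : ∀ {n} → (Letter n → Bool) → Word n → ℕ
count p [] = 0
count p (c ∷ w) = if p c then suc (count p w) else count p w

anyL : ∀ {n} → (Letter n → Bool) → Word n → Bool
anyL p [] = false
anyL p (c ∷ w) = p c ∨ anyL p w

hasInv : ∀ {n} → Fin n → Word n → Bool
hasInv i [] = false
hasInv i (c ∷ w) = (isX i c ∧ anyL (isY i) w) ∨ hasInv i w

replaceFirst : ∀ {n} → (Letter n → Bool) → (Letter n → Letter n) → Word n → Maybe (Word n)
replaceFirst p g [] = nothing
replaceFirst p g (c ∷ w) =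
  if p c then just (g c ∷ w) else Maybe.map (c ∷_) (replaceFirst p g w)

eqL : ∀ {n} → Fin n → Letter n → Bool
eqL j (num k) = ⌊ k ≟ j ⌋
eqL j (bar k) = false

eqB : ∀ {n} → Fin n → Letter n → Bool
eqB j (num k) = false
eqB j (bar k) = ⌊ k ≟ j ⌋

wt : ∀ {n} → Word n → Vec ℤ n
wt w = tabulate (λ j → + count (eqL j) w - + count (eqB j) w)

data ℕ∞ : Set where
  fin : ℕ → ℕ∞
  ∞ : ℕ∞

ε̈ : ∀ {n} → Fin n → Word n → ℕ∞
ε̈ i w = if hasInv i w then ∞ else fin (count (isY i) w)

φ̈ : ∀ {n} → Fin n → Word n → ℕ∞
φ̈ i w = if hasInv i w then ∞ else fin (count (isX i) w)

ë : ∀ {n} → Fin n → Word n → Maybe (Word n)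
ë i w = if hasInv i w then nothing
        else Maybe.map reverse (replaceFirst (isY i) (eImg i) (reverse w))

f̈ : ∀ {n} → Fin n → Word n → Maybe (Word n)
f̈ i w = if hasInv i w then nothing else replaceFirst (isX i) (fImg i) w

data Reach {n : ℕ} (u : Word n) : Word n → Set where
  here  : Reach u u
  stepE : ∀ {x y} → Reach u x → (i : Fin n) → ë i x ≡ just y → Reach u y
  stepF : ∀ {x y} → Reach u x → (i : Fin n) → f̈ i x ≡ just y → Reach u y

Comp : ∀ {n} → Word n → Set
Comp {n} u = Σ (Word n) (Reach u)

-- ψ is a bijection C(u) → C(v) (elements compared by their underlying words)
IsBij : ∀ {n} {u v : Word n} → (Comp u → Comp v) → Set
IsBij {n} {u} {v} ψ =
  ((a b : Comp u) → proj₁ a ≡ proj₁ b → proj₁ (ψ a) ≡ proj₁ (ψ b)) ×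
  ((a b : Comp u) → proj₁ (ψ a) ≡ proj₁ (ψ b) → proj₁ a ≡ proj₁ b) ×
  ((b : Comp v) → Σ (Comp u) λ a → proj₁ (ψ a) ≡ proj₁ b)

IsQCIso : ∀ {n} {u v : Word n} → (Comp u → Comp v) → Set
IsQCIso {n} {u} {v} ψ = ∀ (a : Comp u) → let x = proj₁ a ; x' = proj₁ (ψ a) in
  (wt x' ≡ wt x) ×
  ((i : Fin n) →
    (ε̈ i x' ≡ ε̈ i x) × (φ̈ i x' ≡ φ̈ i x) ×
    (∀ y → (eq : ë i x ≡ just y) → ë i x' ≡ just (proj₁ (ψ (y , stepE (proj₂ a) i eq)))) ×
    (∀ y' → ë i x' ≡ just y' → Σ (Word n) λ y → ë i x ≡ just y) ×
    (∀ y → (eq : f̈ i x ≡ just y) → f̈ i x' ≡ just (proj₁ (ψ (y , stepF (proj₂ a) i eq)))) ×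
    (∀ y' → f̈ i x' ≡ just y' → Σ (Word n) λ y → f̈ i x ≡ just y))

_≈h_ : ∀ {n} → Word n → Word n → Set
_≈h_ {n} u v = Σ (Comp u → Comp v) λ ψ →
  (proj₁ (ψ (u , here)) ≡ v) × IsBij ψ × IsQCIso ψ

idx1 : ∀ {n} → 2 ≤ n → Fin n
idx1 (s≤s _) = zero

special : ∀ {n} → 2 ≤ n → Letter n → List (Word n)
special h a = (a ∷ num o ∷ bar o ∷ []) ∷ (num o ∷ a ∷ bar o ∷ []) ∷ (num o ∷ bar o ∷ a ∷ []) ∷ []
  where o = idx1 h

module Submission where

-- The three words a 1 1̄, 1 a 1̄ and 1 1̄ a are equivalent: the letters 1 and 1̄ are inert for
-- every index i ≥ 2 and create an inversion for i = 1, so each of these words carries the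
-- structure of the single letter a.  Conversely, let ψ witness x y z ≈ x′ y′ z′.  Lowering x y z
-- by ë's (the letter ranks strictly decrease) reaches a highest weight word h, ψ lowers x′ y′ z′
-- along the same indices to ψ h, again of highest weight, and similarity of h and ψ h lifts back
-- up because every ë_i is undone by f̈_i.  Highest weight words of length three are listed
-- explicitly.  Two of them related by ψ agree on weight, ε̈ and φ̈, also after any sequence of
-- f̈'s.  The finitely many such words over 1, 2, 3 are compared by computation, except 112/121
-- and 122/212, which are separated only by a path f̈_2 f̈_3 ⋯ f̈_n ⋯ f̈_3 f̈_2 through every
-- index; each remaining highest weight word has weight ±e_r and is determined by r, the sign,
-- and an inversion at r or r + 1.


open import Defs
open import Data.Bool using (Bool; true; false; if_then_else_; _∧_; _∨_)
open import Data.Bool.Properties using (¬-not; ∨-assoc; ∨-comm; ∨-identityʳ; ∨-zeroʳ; ∧-zeroʳ; ∧-identityʳ)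
open import Data.Empty using (⊥; ⊥-elim)
open import Data.Fin using (Fin; zero; suc; _≟_; toℕ; inject₁)
open import Data.Fin.Properties using (toℕ-injective; toℕ<n)
import Data.Fin.Properties as Fin
open import Data.Integer using (ℤ; +_; -[1+_]; _-_)
import Data.Integer.Properties as ℤ
open import Data.List using (List; []; _∷_; _++_; reverse; length; map)
open import Data.List.Properties
  using (∷-injectiveˡ; ++-cancelˡ; reverse-++; reverse-involutive; unfold-reverse; length-++; ++-assoc; map-++; map-cong)
import Data.List.Properties as List
open import Data.List.Membership.Propositional using (_∈_)
import Data.List.Membership.DecPropositional
open import Data.List.Relation.Unary.All using (All; all?)
import Data.List.Relation.Unary.All as All
open import Data.List.Relation.Unary.Any using (Any; here; there; any?; satisfied)
open import Data.Maybe using (Maybe; just; nothing)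
import Data.Maybe as Maybe
open import Data.Maybe.Properties using (just-injective)
import Data.Maybe.Properties as Maybe
open import Data.Maybe.Relation.Binary.Pointwise using (Pointwise)
import Data.Maybe.Relation.Binary.Pointwise as Pointwise
open import Data.Nat using (ℕ; zero; suc; _+_; _∸_; _<_; _≤_; s≤s; z≤n)
import Data.Nat as ℕ
open import Data.Nat.Induction using (<-wellFounded)
open import Data.Nat.ListAction using (sum)
open import Data.Nat.ListAction.Properties using (sum-++)
open import Data.Nat.Properties
  using (suc-injective; +-monoˡ-<; +-monoʳ-<; ∸-monoʳ-<; <⇒≤; <-≤-trans; m≤m+n; <-trans; <-irrefl; ≤-refl)
open import Data.Product using (Σ; Σ-syntax; ∃; _×_; _,_; proj₁; proj₂; map₂)
import Data.Product.Properties as Σ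
open import Data.Sum using (_⊎_; inj₁; inj₂; [_,_]′)
open import Data.Unit using (tt)
open import Data.Vec using (Vec; lookup)
open import Data.Vec.Properties using (tabulate-cong; lookup∘tabulate)
open import Function using (_∘_)
open import Function.Bundles using (_⇔_; mk⇔)
open import Induction.WellFounded using (Acc; acc)
open import Relation.Binary.Definitions using (DecidableEquality)
open import Relation.Binary.PropositionalEquality
  using (_≡_; _≢_; refl; sym; trans; cong; cong₂; subst; subst₂; module ≡-Reasoning)
open import Relation.Nullary using (¬_; Dec; yes; no)
import Relation.Nullary.Decidable as Dec
open import Relation.Nullary.Decidable using (⌊_⌋; True; toWitness; _×-dec_; _⊎-dec_; _→-dec_; ⌊⌋-map′)

≟-diag : ∀ {n} (i : Fin n) → ⌊ i ≟ i ⌋ ≡ true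
≟-diag i with i ≟ i
... | yes _ = refl
... | no i≢i = ⊥-elim (i≢i refl)

≟-≢ : ∀ {n} {i j : Fin n} → i ≢ j → ⌊ i ≟ j ⌋ ≡ false
≟-≢ {i = i} {j} i≢j with i ≟ j
... | yes i≡j = ⊥-elim (i≢j i≡j)
... | no _ = refl

≟-sound : ∀ {n} {i j : Fin n} → ⌊ i ≟ j ⌋ ≡ true → i ≡ j
≟-sound {i = i} {j} e with i ≟ j
... | yes i≡j = i≡j

toℕ-next : ∀ {n} (i : Fin n) {k} → next i ≡ just k → toℕ k ≡ suc (toℕ i)
toℕ-next {suc (suc n)} zero refl = refl
toℕ-next {suc (suc n)} (suc i) e with next i in eq
toℕ-next {suc (suc n)} (suc i) refl | just k = cong suc (toℕ-next i eq)

next-< : ∀ {n} {i k : Fin n} → next i ≡ just k → toℕ i < toℕ k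
next-< {i = i} e rewrite toℕ-next i e = ≤-refl

next-≢ : ∀ {n} {i k : Fin n} → next i ≡ just k → i ≢ k
next-≢ e refl = <-irrefl refl (next-< e)

next-injective : ∀ {n} {i j k : Fin n} → next i ≡ just k → next j ≡ just k → i ≡ j
next-injective {i = i} {j} ei ej = toℕ-injective (suc-injective (trans (sym (toℕ-next i ei)) (toℕ-next j ej)))

next-inject₁ : ∀ {m} (j : Fin (suc m)) → next (inject₁ j) ≡ just (suc j)
next-inject₁ {zero} zero = refl
next-inject₁ {suc m} zero = refl
next-inject₁ {suc m} (suc j) rewrite next-inject₁ j = refl

next-cycle : ∀ {n} {i k : Fin n} → next i ≡ just k → next k ≡ just i → ⊥
next-cycle e e′ = <-irrefl refl (<-trans (next-< e) (next-< e′))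

next-≢-zero : ∀ {n} {i : Fin (suc n)} → next i ≢ just zero
next-≢-zero {i = i} e with toℕ-next i e
... | ()

data XLetter {n} (i : Fin n) : Letter n → Set where
  xnum : XLetter i (num i)
  xbar : ∀ {k} → next i ≡ just k → XLetter i (bar k)

data YLetter {n} (i : Fin n) : Letter n → Set where
  ynum : ∀ {k} → next i ≡ just k → YLetter i (num k)
  ybar : YLetter i (bar i)

xLetter : ∀ {n} (i : Fin n) c → isX i c ≡ true → XLetter i c
xLetter i (num j) e with ≟-sound e
... | refl = xnum
xLetter i (bar j) e with next i in eq
... | just k with ≟-sound e
... | refl = xbar eq

yLetter : ∀ {n} (i : Fin n) c → isY i c ≡ true → YLetter i c
yLetter i (num j) e with next i in eq
... | just k with ≟-sound e
... | refl = ynum eq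
yLetter i (bar j) e with ≟-sound e
... | refl = ybar

isX-num : ∀ {n} (i : Fin n) → isX i (num i) ≡ true
isX-num i = ≟-diag i

isX-bar : ∀ {n} (i : Fin n) {k} → next i ≡ just k → isX i (bar k) ≡ true
isX-bar i {k} e rewrite e = ≟-diag k

isY-num : ∀ {n} (i : Fin n) {k} → next i ≡ just k → isY i (num k) ≡ true
isY-num i {k} e rewrite e = ≟-diag k

isY-bar : ∀ {n} (i : Fin n) → isY i (bar i) ≡ true
isY-bar i = ≟-diag i

X⇒¬Y : ∀ {n} (i : Fin n) c → isX i c ≡ true → isY i c ≡ false
X⇒¬Y i c x with xLetter i c x
... | xnum with next i in eq
...   | nothing = refl
...   | just k = ≟-≢ (next-≢ eq)
X⇒¬Y i _ x | xbar {k} e = ≟-≢ (λ k≡i → next-≢ e (sym k≡i))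

Y⇒¬X : ∀ {n} (i : Fin n) c → isY i c ≡ true → isX i c ≡ false
Y⇒¬X i c y with isX i c in x
... | false = refl
... | true with trans (sym (X⇒¬Y i c x)) y
...   | ()

eImg-isX : ∀ {n} (i : Fin n) c → isY i c ≡ true → isX i (eImg i c) ≡ true
eImg-isX i c y with yLetter i c y
... | ynum _ = isX-num i
... | ybar with next i in eq
...   | just k = isX-bar i eq
...   | nothing = isX-num i

fImg-eImg : ∀ {n} (i : Fin n) c → isY i c ≡ true → fImg i (eImg i c) ≡ c
fImg-eImg i c y with yLetter i c y
... | ynum e rewrite e = refl
... | ybar with next i in eq
...   | just k = refl
...   | nothing rewrite eq = refl

rank : ∀ {n} → Letter n → ℕ
rank (num j) = toℕ j
rank {n} (bar j) = n + (n ∸ toℕ j)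

rank-eImg : ∀ {n} (i : Fin n) c → isY i c ≡ true → rank (eImg i c) < rank c
rank-eImg i c y with yLetter i c y
... | ynum e = next-< e
rank-eImg {n} i _ y | ybar with next i in eq
... | just k = +-monoʳ-< n (∸-monoʳ-< (next-< eq) (<⇒≤ (toℕ<n k)))
... | nothing = <-≤-trans (toℕ<n i) (m≤m+n n _)

∨-false : ∀ x {y} → x ∨ y ≡ false → (x ≡ false) × (y ≡ false)
∨-false false e = refl , e

anyL-++ : ∀ {n} (p : Letter n → Bool) xs ys → anyL p (xs ++ ys) ≡ anyL p xs ∨ anyL p ys
anyL-++ p [] ys = refl
anyL-++ p (x ∷ xs) ys rewrite anyL-++ p xs ys = sym (∨-assoc (p x) (anyL p xs) (anyL p ys))

anyL-reverse : ∀ {n} (p : Letter n → Bool) xs → anyL p (reverse xs) ≡ anyL p xs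
anyL-reverse p [] = refl
anyL-reverse p (x ∷ xs) = begin
  anyL p (reverse (x ∷ xs))          ≡⟨ cong (anyL p) (unfold-reverse x xs) ⟩
  anyL p (reverse xs ++ x ∷ [])      ≡⟨ anyL-++ p (reverse xs) (x ∷ []) ⟩
  anyL p (reverse xs) ∨ (p x ∨ false) ≡⟨ cong₂ _∨_ (anyL-reverse p xs) (∨-identityʳ (p x)) ⟩
  anyL p xs ∨ p x                    ≡⟨ ∨-comm (anyL p xs) (p x) ⟩
  p x ∨ anyL p xs                    ∎
  where open ≡-Reasoning

anyL-mid : ∀ {n} (p : Letter n → Bool) pre {c} suf → p c ≡ true → anyL p (pre ++ c ∷ suf) ≡ true
anyL-mid p [] suf pc rewrite pc = refl
anyL-mid p (x ∷ pre) suf pc rewrite anyL-mid p pre suf pc = ∨-zeroʳ (p x)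

reverse-mid : ∀ {A : Set} (xs : List A) c ys → reverse (xs ++ c ∷ ys) ≡ reverse ys ++ c ∷ reverse xs
reverse-mid xs c ys = begin
  reverse (xs ++ c ∷ ys)                ≡⟨ reverse-++ xs (c ∷ ys) ⟩
  reverse (c ∷ ys) ++ reverse xs        ≡⟨ cong (_++ reverse xs) (unfold-reverse c ys) ⟩
  (reverse ys ++ c ∷ []) ++ reverse xs  ≡⟨ ++-assoc (reverse ys) (c ∷ []) (reverse xs) ⟩
  reverse ys ++ c ∷ reverse xs          ∎
  where open ≡-Reasoning

replaceFirst-just : ∀ {n} (p : Letter n → Bool) g w {y} → replaceFirst p g w ≡ just y →
  Σ[ pre ∈ Word n ] Σ[ c ∈ Letter n ] Σ[ suf ∈ Word n ]
    (w ≡ pre ++ c ∷ suf) × (y ≡ pre ++ g c ∷ suf) × (anyL p pre ≡ false) × (p c ≡ true)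
replaceFirst-just p g (c ∷ w) e with p c in pc
... | true = [] , c , w , refl , sym (just-injective e) , refl , pc
... | false with replaceFirst p g w in e′
...   | just y′ with replaceFirst-just p g w e′ | just-injective e
...     | pre , d , suf , refl , refl , clear , pd | refl =
  c ∷ pre , d , suf , refl , refl , trans (cong (_∨ anyL p pre) pc) clear , pd

replaceFirst-nothing : ∀ {n} (p : Letter n → Bool) g w → replaceFirst p g w ≡ nothing → anyL p w ≡ false
replaceFirst-nothing p g [] e = refl
replaceFirst-nothing p g (c ∷ w) e with p c
... | false with replaceFirst p g w in e′
...   | nothing = replaceFirst-nothing p g w e′

replaceFirst-at : ∀ {n} (p : Letter n → Bool) g pre {c} suf → anyL p pre ≡ false → p c ≡ true →
  replaceFirst p g (pre ++ c ∷ suf) ≡ just (pre ++ g c ∷ suf)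
replaceFirst-at p g [] suf clear pc rewrite pc = refl
replaceFirst-at p g (d ∷ pre) suf clear pc with ∨-false (p d) clear
... | pd , clear′ rewrite pd | replaceFirst-at p g pre suf clear′ pc = refl

hasInv-noY : ∀ {n} (i : Fin n) w → anyL (isY i) w ≡ false → hasInv i w ≡ false
hasInv-noY i [] _ = refl
hasInv-noY i (c ∷ w) noY with ∨-false (isY i c) noY
... | _ , noY′ rewrite noY′ | hasInv-noY i w noY′ | ∧-zeroʳ (isX i c) = refl

hasInv-mid : ∀ {n} (i : Fin n) pre c suf → anyL (isX i) pre ≡ false → anyL (isY i) suf ≡ false →
  hasInv i (pre ++ c ∷ suf) ≡ false
hasInv-mid i [] c suf _ noY rewrite noY | hasInv-noY i suf noY = trans (∨-identityʳ _) (∧-zeroʳ (isX i c))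
hasInv-mid i (d ∷ pre) c suf noX noY with ∨-false (isX i d) noX
... | xd , noX′ rewrite xd = hasInv-mid i pre c suf noX′ noY

hasInv-witness : ∀ {n} (i : Fin n) pre {c} w → isX i c ≡ true → anyL (isY i) w ≡ true → hasInv i (pre ++ c ∷ w) ≡ true
hasInv-witness i [] w xc yw rewrite xc | yw = refl
hasInv-witness i (d ∷ pre) {c} w xc yw rewrite hasInv-witness i pre {c} w xc yw = ∨-zeroʳ _

noX-before-Y : ∀ {n} (i : Fin n) pre {c} suf → hasInv i (pre ++ c ∷ suf) ≡ false → isY i c ≡ true →
  anyL (isX i) pre ≡ false
noX-before-Y i [] suf _ _ = refl
noX-before-Y i (d ∷ pre) {c} suf noInv yc
  with ∨-false (isX i d ∧ anyL (isY i) (pre ++ c ∷ suf)) noInv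
... | xd∧Y , noInv′ = cong₂ _∨_ xd (noX-before-Y i pre suf noInv′ yc)
  where
  xd : isX i d ≡ false
  xd = trans (sym (trans (cong (isX i d ∧_) (anyL-mid (isY i) pre suf yc)) (∧-identityʳ (isX i d)))) xd∧Y

ë-just : ∀ {n} (i : Fin n) w {y} → ë i w ≡ just y →
  (hasInv i w ≡ false) × Σ[ pre ∈ Word n ] Σ[ c ∈ Letter n ] Σ[ suf ∈ Word n ]
    (w ≡ pre ++ c ∷ suf) × (y ≡ pre ++ eImg i c ∷ suf) × (isY i c ≡ true) × (anyL (isY i) suf ≡ false)
ë-just i w e with hasInv i w
... | false with replaceFirst (isY i) (eImg i) (reverse w) in r
...   | just _ with replaceFirst-just (isY i) (eImg i) (reverse w) r | just-injective e
...     | pre , c , suf , w≡ , refl , clear , yc | refl =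
  refl , reverse suf , c , reverse pre , w≡′ , reverse-mid pre (eImg i c) suf , yc , trans (anyL-reverse (isY i) pre) clear
  where
  w≡′ : w ≡ reverse suf ++ c ∷ reverse pre
  w≡′ = trans (sym (reverse-involutive w)) (trans (cong reverse w≡) (reverse-mid pre c suf))

f̈-at : ∀ {n} {i : Fin n} pre {d} suf → anyL (isX i) pre ≡ false → isX i d ≡ true → anyL (isY i) suf ≡ false →
  f̈ i (pre ++ d ∷ suf) ≡ just (pre ++ fImg i d ∷ suf)
f̈-at {i = i} pre {d} suf noX xd noY
  rewrite hasInv-mid i pre d suf noX noY = replaceFirst-at (isX i) (fImg i) pre suf noX xd

ë⇒f̈ : ∀ {n} (i : Fin n) x {y} → ë i x ≡ just y → f̈ i y ≡ just x
ë⇒f̈ i x e with ë-just i x e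
... | noInv , pre , c , suf , refl , refl , yc , noY =
  trans (f̈-at pre suf (noX-before-Y i pre suf noInv yc) (eImg-isX i c yc) noY)
        (cong (λ d → just (pre ++ d ∷ suf)) (fImg-eImg i c yc))

ë-length : ∀ {n} (i : Fin n) x {y} → ë i x ≡ just y → length y ≡ length x
ë-length i x e with ë-just i x e
... | _ , pre , c , suf , refl , refl , _ = trans (length-++ pre) (sym (length-++ pre))

rankSum : ∀ {n} → Word n → ℕ
rankSum w = sum (map rank w)

rankSum-mid : ∀ {n} (pre : Word n) c suf → rankSum (pre ++ c ∷ suf) ≡ rankSum pre + (rank c + rankSum suf)
rankSum-mid pre c suf = trans (cong sum (map-++ rank pre (c ∷ suf))) (sum-++ (map rank pre) (map rank (c ∷ suf)))

ë-rankSum : ∀ {n} (i : Fin n) x {y} → ë i x ≡ just y → rankSum y < rankSum x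
ë-rankSum i x e with ë-just i x e
... | _ , pre , c , suf , refl , refl , yc , _ rewrite rankSum-mid pre (eImg i c) suf | rankSum-mid pre c suf =
  +-monoʳ-< (rankSum pre) (+-monoˡ-< (rankSum suf) (rank-eImg i c yc))

Y-blocked⇒inversion : ∀ {n} (i : Fin n) w → ë i w ≡ nothing → anyL (isY i) w ≡ true → hasInv i w ≡ true
Y-blocked⇒inversion i w e yw with hasInv i w
... | true = refl
... | false with replaceFirst (isY i) (eImg i) (reverse w) in r
...   | nothing with trans (sym (anyL-reverse (isY i) w)) (replaceFirst-nothing (isY i) (eImg i) (reverse w) r)
...     | noY with trans (sym yw) noY
...       | ()

-- Descent to a highest weight word

HighestWeight : ∀ {n} → Word n → Set
HighestWeight {n} w = (i : Fin n) → ë i w ≡ nothing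

data Descent {n} : Word n → Word n → Set where
  done : ∀ {w} → Descent w w
  step : ∀ {w w′ h} (i : Fin n) → ë i w ≡ just w′ → Descent w′ h → Descent w h

Descent-length : ∀ {n} {w h : Word n} → Descent w h → length h ≡ length w
Descent-length done = refl
Descent-length {w = w} (step i e d) = trans (Descent-length d) (ë-length i w e)

ë-defined? : ∀ {n} (i : Fin n) w → Dec (∃ λ y → ë i w ≡ just y)
ë-defined? i w with ë i w
... | just y = yes (y , refl)
... | nothing = no λ ()

ë-undefined : ∀ {n} {i : Fin n} {w} → ¬ (∃ λ y → ë i w ≡ just y) → ë i w ≡ nothing
ë-undefined {i = i} {w} undefined with ë i w
... | nothing = refl
... | just y = ⊥-elim (undefined (y , refl))

highestWeight? : ∀ {n} (w : Word n) → HighestWeight w ⊎ Σ[ i ∈ Fin n ] Σ[ y ∈ Word n ] ë i w ≡ just y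
highestWeight? w with Fin.any? (λ i → ë-defined? i w)
... | yes (i , y , e) = inj₂ (i , y , e)
... | no none = inj₁ λ i → ë-undefined {i = i} {w} λ defined → none (i , defined)

descend : ∀ {n} (w : Word n) → Acc _<_ (rankSum w) → Σ[ h ∈ Word n ] Descent w h × HighestWeight h
descend w (acc smaller) with highestWeight? w
... | inj₁ hw = w , done , hw
... | inj₂ (i , y , e) with descend y (smaller (ë-rankSum i w e))
...   | h , d , hw = h , step i e d , hw

Neutral : ∀ {n} → Fin n → Word n → Set
Neutral i w = (anyL (isX i) w ≡ false) × (anyL (isY i) w ≡ false)

replaceFirst-clear : ∀ {n} (p : Letter n → Bool) g w → anyL p w ≡ false → replaceFirst p g w ≡ nothing
replaceFirst-clear p g [] _ = refl
replaceFirst-clear p g (c ∷ w) clear with ∨-false (p c) clear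
... | pc , clear′ rewrite pc | replaceFirst-clear p g w clear′ = refl

count-clear : ∀ {n} (p : Letter n → Bool) w → anyL p w ≡ false → count p w ≡ 0
count-clear p [] _ = refl
count-clear p (c ∷ w) clear with ∨-false (p c) clear
... | pc , clear′ rewrite pc = count-clear p w clear′

count-lone : ∀ {n} (p : Letter n → Bool) pre a suf → anyL p pre ≡ false → anyL p suf ≡ false →
  count p (pre ++ a ∷ suf) ≡ count p (a ∷ [])
count-lone p [] a suf _ clear rewrite count-clear p suf clear = refl
count-lone p (d ∷ pre) a suf clear clear′ with ∨-false (p d) clear
... | pd , clear″ rewrite pd = count-lone p pre a suf clear″ clear′

count-shift : ∀ {n} (p : Letter n → Bool) pre a suf → count p (pre ++ a ∷ suf) ≡ count p (a ∷ pre ++ suf)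
count-shift p [] a suf = refl
count-shift p (d ∷ pre) a suf rewrite count-shift p pre a suf with p a | p d
... | true | true = refl
... | true | false = refl
... | false | true = refl
... | false | false = refl

ëLetter : ∀ {n} → Fin n → Letter n → Maybe (Letter n)
ëLetter i a = if isY i a then just (eImg i a) else nothing

f̈Letter : ∀ {n} → Fin n → Letter n → Maybe (Letter n)
f̈Letter i a = if isX i a then just (fImg i a) else nothing

module _ {n} (i : Fin n) (pre suf : Word n) (neutral-pre : Neutral i pre) (neutral-suf : Neutral i suf) where

  private
    insert : Letter n → Word n
    insert b = pre ++ b ∷ suf

  hasInv-lone : ∀ a → hasInv i (insert a) ≡ false
  hasInv-lone a = hasInv-mid i pre a suf (proj₁ neutral-pre) (proj₂ neutral-suf)

  ë-lone : ∀ a → ë i (insert a) ≡ Maybe.map insert (ëLetter i a)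
  ë-lone a rewrite hasInv-lone a | reverse-mid pre a suf with isY i a in ya
  ... | true =
    trans (cong (Maybe.map reverse)
                (replaceFirst-at (isY i) (eImg i) (reverse suf) (reverse pre)
                                 (trans (anyL-reverse (isY i) suf) (proj₂ neutral-suf)) ya))
    (cong just (trans (reverse-mid (reverse suf) (eImg i a) (reverse pre))
                     (cong₂ (λ xs ys → xs ++ eImg i a ∷ ys) (reverse-involutive pre) (reverse-involutive suf))))
  ... | false = cong (Maybe.map reverse) (replaceFirst-clear (isY i) (eImg i) (reverse suf ++ a ∷ reverse pre) noY)
    where
    noY : anyL (isY i) (reverse suf ++ a ∷ reverse pre) ≡ false
    noY = trans (anyL-++ (isY i) (reverse suf) (a ∷ reverse pre))
                (cong₂ _∨_ (trans (anyL-reverse (isY i) suf) (proj₂ neutral-suf))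
                           (cong₂ _∨_ ya (trans (anyL-reverse (isY i) pre) (proj₂ neutral-pre))))

  f̈-lone : ∀ a → f̈ i (insert a) ≡ Maybe.map insert (f̈Letter i a)
  f̈-lone a rewrite hasInv-lone a with isX i a in xa
  ... | true = replaceFirst-at (isX i) (fImg i) pre suf (proj₁ neutral-pre) xa
  ... | false = replaceFirst-clear (isX i) (fImg i) (insert a)
                  (trans (anyL-++ (isX i) pre (a ∷ suf)) (cong₂ _∨_ (proj₁ neutral-pre) (cong₂ _∨_ xa (proj₁ neutral-suf))))

  ε̈-lone : ∀ a → ε̈ i (insert a) ≡ ε̈ i (a ∷ [])
  ε̈-lone a rewrite hasInv-lone a | hasInv-mid i [] a [] refl refl =
    cong fin (count-lone (isY i) pre a suf (proj₂ neutral-pre) (proj₂ neutral-suf))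

  φ̈-lone : ∀ a → φ̈ i (insert a) ≡ φ̈ i (a ∷ [])
  φ̈-lone a rewrite hasInv-lone a | hasInv-mid i [] a [] refl refl =
    cong fin (count-lone (isX i) pre a suf (proj₁ neutral-pre) (proj₁ neutral-suf))

-- The words a 1 1̄, 1 a 1̄ and 1 1̄ a

data Slot : Set where
  first second third : Slot

module _ {m : ℕ} where

  private
    N : ℕ
    N = suc (suc m)

  2≤N : 2 ≤ N
  2≤N = s≤s (s≤s z≤n)

  prefix suffix : Slot → Word N
  prefix first = []
  prefix second = num zero ∷ []
  prefix third = num zero ∷ bar zero ∷ []
  suffix first = num zero ∷ bar zero ∷ []
  suffix second = bar zero ∷ []
  suffix third = []

  specialWord : Slot → Letter N → Word N
  specialWord s a = prefix s ++ a ∷ suffix s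

  specialWord-∈ : ∀ s a → specialWord s a ∈ special 2≤N a
  specialWord-∈ first a = here refl
  specialWord-∈ second a = there (here refl)
  specialWord-∈ third a = there (there (here refl))

  ∈-special : ∀ {w a} → w ∈ special 2≤N a → Σ[ s ∈ Slot ] w ≡ specialWord s a
  ∈-special (here e) = first , e
  ∈-special (there (here e)) = second , e
  ∈-special (there (there (here e))) = third , e

  specialWord-injective : ∀ s {a b} → specialWord s a ≡ specialWord s b → a ≡ b
  specialWord-injective s e = ∷-injectiveˡ (++-cancelˡ (prefix s) _ _ e)

  one-neutral : (j : Fin (suc m)) → Neutral (suc j) (num zero ∷ bar zero ∷ [])
  one-neutral j with next j
  ... | just _ = refl , refl
  ... | nothing = refl , refl

  prefix-neutral : ∀ s (j : Fin (suc m)) → Neutral (suc j) (prefix s)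
  prefix-neutral first j = refl , refl
  prefix-neutral second j with next j
  ... | just _ = refl , refl
  ... | nothing = refl , refl
  prefix-neutral third j = one-neutral j

  suffix-neutral : ∀ s (j : Fin (suc m)) → Neutral (suc j) (suffix s)
  suffix-neutral first j = one-neutral j
  suffix-neutral second j with next j
  ... | just _ = refl , refl
  ... | nothing = refl , refl
  suffix-neutral third j = refl , refl

  hasInv-special : ∀ s a → hasInv zero (specialWord s a) ≡ true
  hasInv-special first a = hasInv-witness zero (a ∷ []) {num zero} (bar zero ∷ []) refl refl
  hasInv-special second a = hasInv-witness zero [] {num zero} (a ∷ bar zero ∷ []) refl (anyL-mid (isY zero) (a ∷ []) {bar zero} [] refl)
  hasInv-special third a = hasInv-witness zero [] {num zero} (bar zero ∷ a ∷ []) refl refl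

  ëSpecial f̈Special : Fin N → Letter N → Maybe (Letter N)
  ëSpecial zero _ = nothing
  ëSpecial (suc j) a = ëLetter (suc j) a
  f̈Special zero _ = nothing
  f̈Special (suc j) a = f̈Letter (suc j) a

  ë-special : ∀ s i a → ë i (specialWord s a) ≡ Maybe.map (specialWord s) (ëSpecial i a)
  ë-special s zero a rewrite hasInv-special s a = refl
  ë-special s (suc j) a = ë-lone (suc j) (prefix s) (suffix s) (prefix-neutral s j) (suffix-neutral s j) a

  f̈-special : ∀ s i a → f̈ i (specialWord s a) ≡ Maybe.map (specialWord s) (f̈Special i a)
  f̈-special s zero a rewrite hasInv-special s a = refl
  f̈-special s (suc j) a = f̈-lone (suc j) (prefix s) (suffix s) (prefix-neutral s j) (suffix-neutral s j) a

  ε̈-special : ∀ s t i a → ε̈ i (specialWord t a) ≡ ε̈ i (specialWord s a)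
  ε̈-special s t zero a rewrite hasInv-special s a | hasInv-special t a = refl
  ε̈-special s t (suc j) a =
    trans (ε̈-lone (suc j) (prefix t) (suffix t) (prefix-neutral t j) (suffix-neutral t j) a)
          (sym (ε̈-lone (suc j) (prefix s) (suffix s) (prefix-neutral s j) (suffix-neutral s j) a))

  φ̈-special : ∀ s t i a → φ̈ i (specialWord t a) ≡ φ̈ i (specialWord s a)
  φ̈-special s t zero a rewrite hasInv-special s a | hasInv-special t a = refl
  φ̈-special s t (suc j) a =
    trans (φ̈-lone (suc j) (prefix t) (suffix t) (prefix-neutral t j) (suffix-neutral t j) a)
          (sym (φ̈-lone (suc j) (prefix s) (suffix s) (prefix-neutral s j) (suffix-neutral s j) a))

  count-special : ∀ (p : Letter N → Bool) s a → count p (specialWord s a) ≡ count p (specialWord first a)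
  count-special p first a = refl
  count-special p second a = count-shift p (prefix second) a (suffix second)
  count-special p third a = count-shift p (prefix third) a (suffix third)

  wt-special : ∀ s t a → wt (specialWord t a) ≡ wt (specialWord s a)
  wt-special s t a = tabulate-cong λ j → cong₂ (λ x y → + x - + y) (shift (eqL j)) (shift (eqB j))
    where
    shift : (p : Letter N → Bool) → count p (specialWord t a) ≡ count p (specialWord s a)
    shift p = trans (count-special p t a) (sym (count-special p s a))

map-just : ∀ {A B : Set} {f : A → B} (m : Maybe A) {y} → Maybe.map f m ≡ just y → Σ[ a ∈ A ] (m ≡ just a) × (f a ≡ y)
map-just (just a) refl = a , refl , refl

record Embedding {n} {A : Set} (ë′ f̈′ : Fin n → A → Maybe A) : Set where
  field
    word : A → Word n
    word-injective : ∀ {a b} → word a ≡ word b → a ≡ b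
    ë-word : ∀ i a → ë i (word a) ≡ Maybe.map word (ë′ i a)
    f̈-word : ∀ i a → f̈ i (word a) ≡ Maybe.map word (f̈′ i a)

module _ {n} {A : Set} {ë′ f̈′ : Fin n → A → Maybe A} where
  open Embedding

  Reach-transfer : (σ τ : Embedding ë′ f̈′) → ∀ {a w} → Reach (word σ a) w →
    Σ[ b ∈ A ] (w ≡ word σ b) × Reach (word τ a) (word τ b)
  Reach-transfer σ τ {a} here = a , refl , here
  Reach-transfer σ τ (stepE r i e) with Reach-transfer σ τ r
  ... | b , refl , r′ with map-just (ë′ i b) (trans (sym (ë-word σ i b)) e)
  ...   | b′ , e′ , refl = b′ , refl , stepE r′ i (trans (ë-word τ i b) (cong (Maybe.map (word τ)) e′))
  Reach-transfer σ τ (stepF r i e) with Reach-transfer σ τ r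
  ... | b , refl , r′ with map-just (f̈′ i b) (trans (sym (f̈-word σ i b)) e)
  ...   | b′ , e′ , refl = b′ , refl , stepF r′ i (trans (f̈-word τ i b) (cong (Maybe.map (word τ)) e′))

  module _ (σ τ : Embedding ë′ f̈′)
           (wt-copy : ∀ a → wt (word τ a) ≡ wt (word σ a))
           (ε̈-copy : ∀ i a → ε̈ i (word τ a) ≡ ε̈ i (word σ a))
           (φ̈-copy : ∀ i a → φ̈ i (word τ a) ≡ φ̈ i (word σ a))
           (a : A) where

    private
      transfer : ∀ {w} → Reach (word σ a) w → Σ[ b ∈ A ] (w ≡ word σ b) × Reach (word τ a) (word τ b)
      transfer = Reach-transfer σ τ

      ψ : Comp (word σ a) → Comp (word τ a)
      ψ (w , r) = word τ (proj₁ (transfer r)) , proj₂ (proj₂ (transfer r))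

      index : (x : Comp (word σ a)) → Σ[ b ∈ A ] (proj₁ x ≡ word σ b) × (proj₁ (ψ x) ≡ word τ b)
      index (w , r) = proj₁ (transfer r) , proj₁ (proj₂ (transfer r)) , refl

      index-≡ : ∀ x y → proj₁ x ≡ proj₁ y → proj₁ (index x) ≡ proj₁ (index y)
      index-≡ x y e = word-injective σ (trans (sym (proj₁ (proj₂ (index x)))) (trans e (proj₁ (proj₂ (index y)))))

      bijective : IsBij ψ
      bijective = (λ x y e → cong (word τ) (index-≡ x y e))
                , (λ x y e → trans (proj₁ (proj₂ (index x)))
                               (trans (cong (word σ) (word-injective τ e)) (sym (proj₁ (proj₂ (index y))))))
                , onto
        where
        onto : (y : Comp (word τ a)) → Σ[ x ∈ Comp (word σ a) ] proj₁ (ψ x) ≡ proj₁ y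
        onto (w , r) with Reach-transfer τ σ r
        ... | b , refl , r′ = (word σ b , r′) , cong (word τ) (sym (word-injective σ (proj₁ (proj₂ (index (word σ b , r′))))))

      module _ (op : Fin n → Word n → Maybe (Word n)) (op′ : Fin n → A → Maybe A)
               (op-σ : ∀ i b → op i (word σ b) ≡ Maybe.map (word σ) (op′ i b))
               (op-τ : ∀ i b → op i (word τ b) ≡ Maybe.map (word τ) (op′ i b))
               (i : Fin n) {b : A} where

        op-forth : ∀ {y b₁} → op i (word σ b) ≡ just y → y ≡ word σ b₁ → op i (word τ b) ≡ just (word τ b₁)
        op-forth e y≡ with map-just (op′ i b) (trans (sym (op-σ i b)) e)
        ... | b′ , e′ , σb′≡y =
          trans (op-τ i b) (cong (Maybe.map (word τ)) (trans e′ (cong just (word-injective σ (trans σb′≡y y≡)))))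

        op-back : ∀ {y′} → op i (word τ b) ≡ just y′ → Σ[ y ∈ Word n ] op i (word σ b) ≡ just y
        op-back e with map-just (op′ i b) (trans (sym (op-τ i b)) e)
        ... | b′ , e′ , _ = word σ b′ , trans (op-σ i b) (cong (Maybe.map (word σ)) e′)

      preserves : IsQCIso ψ
      preserves (w , r) =
        trans (wt-copy b) (cong wt (sym w≡)) , λ i →
        trans (ε̈-copy i b) (cong (ε̈ i) (sym w≡)) ,
        trans (φ̈-copy i b) (cong (φ̈ i) (sym w≡)) ,
        (λ y e → op-forth ë ë′ (ë-word σ) (ë-word τ) i (at (ë i) e) (proj₁ (proj₂ (transfer (stepE r i e))))) ,
        (λ y′ e → map₂ (trans (cong (ë i) w≡)) (op-back ë ë′ (ë-word σ) (ë-word τ) i e)) ,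
        (λ y e → op-forth f̈ f̈′ (f̈-word σ) (f̈-word τ) i (at (f̈ i) e) (proj₁ (proj₂ (transfer (stepF r i e))))) ,
        (λ y′ e → map₂ (trans (cong (f̈ i) w≡)) (op-back f̈ f̈′ (f̈-word σ) (f̈-word τ) i e))
        where
        b = proj₁ (transfer r)
        w≡ = proj₁ (proj₂ (transfer r))
        at : ∀ {y} (op : Word n → Maybe (Word n)) → op w ≡ just y → op (word σ b) ≡ just y
        at op e = trans (cong op (sym w≡)) e

    copy-≈h : word σ a ≈h word τ a
    copy-≈h = ψ , refl , bijective , preserves

≈h-refl : ∀ {n} (w : Word n) → w ≈h w
≈h-refl w = (λ x → x) , refl , ((λ _ _ e → e) , (λ _ _ e → e) , (λ y → y , refl)) ,
  λ _ → refl , λ _ → refl , refl , (λ _ e → e) , (λ y′ e → y′ , e) , (λ _ e → e) , (λ y′ e → y′ , e)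

module _ {m : ℕ} where

  private
    N : ℕ
    N = suc (suc m)

  special-embedding : Slot → Embedding {suc (suc m)} ëSpecial f̈Special
  special-embedding s = record
    { word = specialWord s
    ; word-injective = specialWord-injective s
    ; ë-word = ë-special s
    ; f̈-word = f̈-special s
    }

  specialWord-≈h : ∀ s t a → specialWord s a ≈h specialWord t a
  specialWord-≈h s t =
    copy-≈h (special-embedding s) (special-embedding t) (wt-special s t) (ε̈-special s t) (φ̈-special s t)

  Similar : Word N → Word N → Set
  Similar w w′ = (w ≡ w′) ⊎ Σ[ a ∈ Letter N ] (w ∈ special 2≤N a) × (w′ ∈ special 2≤N a)

  Similar⇒≈h : ∀ {w w′} → Similar w w′ → w ≈h w′
  Similar⇒≈h (inj₁ refl) = ≈h-refl _
  Similar⇒≈h (inj₂ (a , w∈ , w′∈)) with ∈-special w∈ | ∈-special w′∈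
  ... | s , refl | t , refl = specialWord-≈h s t a

  Similar-raise : ∀ {i x x′ y y′} → ë i x ≡ just y → ë i x′ ≡ just y′ → Similar y y′ → Similar x x′
  Similar-raise {i} {x} {x′} e e′ (inj₁ refl) = inj₁ (just-injective (trans (sym (ë⇒f̈ i x e)) (ë⇒f̈ i x′ e′)))
  Similar-raise {i} {x} {x′} e e′ (inj₂ (a , y∈ , y′∈)) with ∈-special y∈ | ∈-special y′∈
  ... | s , refl | t , refl
    with map-just (f̈Special i a) (trans (sym (f̈-special s i a)) (ë⇒f̈ i x e))
       | map-just (f̈Special i a) (trans (sym (f̈-special t i a)) (ë⇒f̈ i x′ e′))
  ... | b , f̈a≡b , refl | b′ , f̈a≡b′ , refl with trans (sym f̈a≡b) f̈a≡b′
  ... | refl = inj₂ (b , specialWord-∈ s b , specialWord-∈ t b)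

f̈⋆ : ∀ {n} → List (Fin n) → Word n → Maybe (Word n)
f̈⋆ [] w = just w
f̈⋆ (i ∷ is) w = f̈ i w Maybe.>>= f̈⋆ is

module Correspondence {n} {u v : Word n} (iso : u ≈h v) where

  private
    ψ = proj₁ iso
    preserves = proj₂ (proj₂ (proj₂ iso))

    ë-forth : ∀ (a : Comp u) i y (e : ë i (proj₁ a) ≡ just y) → ë i (proj₁ (ψ a)) ≡ just (proj₁ (ψ (y , stepE (proj₂ a) i e)))
    ë-forth a i = proj₁ (proj₂ (proj₂ (proj₂ (preserves a) i)))

    ë-back : ∀ (a : Comp u) i y′ → ë i (proj₁ (ψ a)) ≡ just y′ → Σ[ y ∈ Word n ] ë i (proj₁ a) ≡ just y
    ë-back a i = proj₁ (proj₂ (proj₂ (proj₂ (proj₂ (preserves a) i))))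

    f̈-forth : ∀ (a : Comp u) i y (e : f̈ i (proj₁ a) ≡ just y) → f̈ i (proj₁ (ψ a)) ≡ just (proj₁ (ψ (y , stepF (proj₂ a) i e)))
    f̈-forth a i = proj₁ (proj₂ (proj₂ (proj₂ (proj₂ (proj₂ (preserves a) i)))))

    f̈-back : ∀ (a : Comp u) i y′ → f̈ i (proj₁ (ψ a)) ≡ just y′ → Σ[ y ∈ Word n ] f̈ i (proj₁ a) ≡ just y
    f̈-back a i = proj₂ (proj₂ (proj₂ (proj₂ (proj₂ (proj₂ (preserves a) i)))))

  _↦_ : Word n → Word n → Set
  x ↦ x′ = Σ[ a ∈ Comp u ] (proj₁ a ≡ x) × (proj₁ (ψ a) ≡ x′)

  u↦v : u ↦ v
  u↦v = (u , here) , refl , proj₁ (proj₂ iso)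

  ↦-wt : ∀ {x x′} → x ↦ x′ → wt x ≡ wt x′
  ↦-wt (a , refl , refl) = sym (proj₁ (preserves a))

  ↦-ε̈ : ∀ {x x′} i → x ↦ x′ → ε̈ i x ≡ ε̈ i x′
  ↦-ε̈ i (a , refl , refl) = sym (proj₁ (proj₂ (preserves a) i))

  ↦-φ̈ : ∀ {x x′} i → x ↦ x′ → φ̈ i x ≡ φ̈ i x′
  ↦-φ̈ i (a , refl , refl) = sym (proj₁ (proj₂ (proj₂ (preserves a) i)))

  ↦-ë : ∀ {x x′ y} i → x ↦ x′ → ë i x ≡ just y → Σ[ y′ ∈ Word n ] (ë i x′ ≡ just y′) × (y ↦ y′)
  ↦-ë {y = y} i ((x , r) , refl , refl) e = _ , ë-forth (x , r) i y e , (y , stepE r i e) , refl , refl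

  ↦-HighestWeight : ∀ {x x′} → x ↦ x′ → HighestWeight x → HighestWeight x′
  ↦-HighestWeight {x′ = x′} (a , refl , refl) hw i with ë i x′ in e′
  ... | nothing = refl
  ... | just _ with ë-back a i _ e′
  ...   | _ , e with trans (sym (hw i)) e
  ...     | ()

  ↦-f̈ : ∀ {x x′} i → x ↦ x′ → Pointwise _↦_ (f̈ i x) (f̈ i x′)
  ↦-f̈ {x′ = x′} i ((x , r) , refl , refl) with f̈ i x in e | f̈ i x′ in e′
  ... | just y | _ with trans (sym e′) (f̈-forth (x , r) i y e)
  ...   | refl = Pointwise.just ((y , stepF r i e) , refl , refl)
  ↦-f̈ i (a , refl , refl) | nothing | nothing = Pointwise.nothing
  ↦-f̈ i (a , refl , refl) | nothing | just _ with f̈-back a i _ e′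
  ... | _ , e″ with trans (sym e) e″
  ...   | ()

  ↦-f̈⋆ : ∀ {x x′} is → x ↦ x′ → Pointwise _↦_ (f̈⋆ is x) (f̈⋆ is x′)
  ↦-f̈⋆ [] x↦x′ = Pointwise.just x↦x′
  ↦-f̈⋆ {x} {x′} (i ∷ is) x↦x′ with f̈ i x | f̈ i x′ | ↦-f̈ i x↦x′
  ... | just _ | just _ | Pointwise.just y↦y′ = ↦-f̈⋆ is y↦y′
  ... | nothing | nothing | Pointwise.nothing = Pointwise.nothing

module _ {m : ℕ} {u v : Word (suc (suc m))} (iso : u ≈h v) where
  open Correspondence iso

  Similar-descent : ∀ {x x′ h} → x ↦ x′ → Descent x h → HighestWeight h →
    (∀ {h′} → h ↦ h′ → length h′ ≡ length x′ → Similar h h′) → Similar x x′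
  Similar-descent x↦x′ done hw separate = separate x↦x′ refl
  Similar-descent {x} {x′} x↦x′ (step i e d) hw separate with ↦-ë i x↦x′ e
  ... | y′ , e′ , y↦y′ =
    Similar-raise e e′ (Similar-descent y↦y′ d hw λ h↦h′ len → separate h↦h′ (trans len (ë-length i x′ e′)))

-- Highest weight words of length three

hasInv-pair : ∀ {n} (i : Fin n) b c → hasInv i (b ∷ c ∷ []) ≡ true → (isX i b ≡ true) × (isY i c ≡ true)
hasInv-pair i b c inv with isX i b | isY i c
... | true | true = refl , refl
... | true | false with trans (sym inv) (hasInv-mid i [] c [] refl refl)
...   | ()
hasInv-pair i b c inv | false | _ with trans (sym inv) (hasInv-mid i [] c [] refl refl)
...   | ()

module _ {n} (i : Fin n) (a b c : Letter n) (blocked : ë i (a ∷ b ∷ c ∷ []) ≡ nothing) where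

  private
    inversion : ∀ pre {d} suf → a ∷ b ∷ c ∷ [] ≡ pre ++ d ∷ suf → isY i d ≡ true → hasInv i (a ∷ b ∷ c ∷ []) ≡ true
    inversion pre suf w≡ yd = Y-blocked⇒inversion i (a ∷ b ∷ c ∷ []) blocked (trans (cong (anyL (isY i)) w≡) (anyL-mid (isY i) pre suf yd))

  blocked-first : isY i a ≡ true → (isX i b ≡ true) × (isY i c ≡ true)
  blocked-first ya with inversion [] (b ∷ c ∷ []) refl ya
  ... | inv rewrite Y⇒¬X i a ya = hasInv-pair i b c inv

  blocked-second : isY i b ≡ true → isX i a ≡ true
  blocked-second yb with isX i a in xa | inversion (a ∷ []) (c ∷ []) refl yb
  ... | true | _ = refl
  ... | false | inv with trans (sym (proj₁ (hasInv-pair i b c inv))) (Y⇒¬X i b yb)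
  ...   | ()

  blocked-third : isY i c ≡ true → (isX i a ≡ true) ⊎ (isX i b ≡ true)
  blocked-third yc with isX i a in xa | inversion (a ∷ b ∷ []) [] refl yc
  ... | true | _ = inj₁ refl
  ... | false | inv = inj₂ (proj₁ (hasInv-pair i b c inv))

module _ {m : ℕ} where

  private
    N : ℕ
    N = suc (suc m)

  -- Constructor names spell the word in the paper's numbering, ˉ marking a bar: hw-1-2-1ˉ is 1 2 1̄.
  data HW3 : Letter N → Letter N → Letter N → Set where
    hw-1-1-1    : HW3 (num zero) (num zero) (num zero)
    hw-1-1-2    : HW3 (num zero) (num zero) (num (suc zero))
    hw-1-1-1ˉ   : HW3 (num zero) (num zero) (bar zero)
    hw-1-2-1    : HW3 (num zero) (num (suc zero)) (num zero)
    hw-1-2-2    : HW3 (num zero) (num (suc zero)) (num (suc zero))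
    hw-1-2-3    : ∀ {k} → next (suc zero) ≡ just k → HW3 (num zero) (num (suc zero)) (num k)
    hw-1-2-1ˉ   : HW3 (num zero) (num (suc zero)) (bar zero)
    hw-1-2-2ˉ   : HW3 (num zero) (num (suc zero)) (bar (suc zero))
    hw-1-1ˉ-1   : HW3 (num zero) (bar zero) (num zero)
    hw-1-1ˉ-2   : HW3 (num zero) (bar zero) (num (suc zero))
    hw-1-1ˉ-1ˉ  : HW3 (num zero) (bar zero) (bar zero)
    hw-2-1-2    : HW3 (num (suc zero)) (num zero) (num (suc zero))
    hw-2-1-1ˉ   : HW3 (num (suc zero)) (num zero) (bar zero)
    hw-s-sˉ-s   : ∀ {t s} → next t ≡ just s → HW3 (num s) (bar s) (num s)
    hw-s-sˉ-tˉ  : ∀ {t s} → next t ≡ just s → HW3 (num s) (bar s) (bar t)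
    hw-jˉ-j-k   : ∀ {j k} → next j ≡ just k → HW3 (bar j) (num j) (num k)
    hw-jˉ-j-jˉ  : ∀ {j} → HW3 (bar j) (num j) (bar j)

  one-or-Y : (c : Letter N) → (c ≡ num zero) ⊎ Σ[ i ∈ Fin N ] isY i c ≡ true
  one-or-Y (num zero) = inj₁ refl
  one-or-Y (num (suc j)) = inj₂ (inject₁ j , isY-num (inject₁ j) (next-inject₁ j))
  one-or-Y (bar j) = inj₂ (j , isY-bar j)

  X-one : ∀ {i : Fin N} → isX i (num zero) ≡ true → i ≡ zero
  X-one x = sym (≟-sound x)

  Y-zero : ∀ (c : Letter N) → isY zero c ≡ true → (c ≡ num (suc zero)) ⊎ (c ≡ bar zero)
  Y-zero c y with yLetter zero c y
  ... | ynum refl = inj₁ refl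
  ... | ybar = inj₂ refl

  private
    Blocked : Letter N → Letter N → Letter N → Set
    Blocked a b c = HighestWeight (a ∷ b ∷ c ∷ [])

    classify-1-1 : ∀ c → Blocked (num zero) (num zero) c → HW3 (num zero) (num zero) c
    classify-1-1 c hw with one-or-Y c
    ... | inj₁ refl = hw-1-1-1
    ... | inj₂ (l , yc) with [ X-one , X-one ]′ (blocked-third l (num zero) (num zero) c (hw l) yc)
    ...   | refl with Y-zero c yc
    ...     | inj₁ refl = hw-1-1-2
    ...     | inj₂ refl = hw-1-1-1ˉ

    classify-1-2 : ∀ c → Blocked (num zero) (num (suc zero)) c → HW3 (num zero) (num (suc zero)) c
    classify-1-2 c hw with one-or-Y c
    ... | inj₁ refl = hw-1-2-1
    ... | inj₂ (l , yc) with blocked-third l (num zero) (num (suc zero)) c (hw l) yc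
    ...   | inj₁ x with X-one x
    ...     | refl with Y-zero c yc
    ...       | inj₁ refl = hw-1-2-2
    ...       | inj₂ refl = hw-1-2-1ˉ
    classify-1-2 c hw | inj₂ (l , yc) | inj₂ x with ≟-sound x
    ... | refl with yLetter (suc zero) c yc
    ...   | ynum e = hw-1-2-3 e
    ...   | ybar = hw-1-2-2ˉ

    classify-1-1ˉ : ∀ c → Blocked (num zero) (bar zero) c → HW3 (num zero) (bar zero) c
    classify-1-1ˉ c hw with one-or-Y c
    ... | inj₁ refl = hw-1-1ˉ-1
    ... | inj₂ (l , yc) with blocked-third l (num zero) (bar zero) c (hw l) yc
    ...   | inj₁ x with X-one x
    ...     | refl with Y-zero c yc
    ...       | inj₁ refl = hw-1-1ˉ-2
    ...       | inj₂ refl = hw-1-1ˉ-1ˉ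
    classify-1-1ˉ c hw | inj₂ (l , yc) | inj₂ x with xLetter l (bar zero) x
    ... | xbar e = ⊥-elim (next-≢-zero {i = l} e)

    classify-1 : ∀ b c → Blocked (num zero) b c → HW3 (num zero) b c
    classify-1 b c hw with one-or-Y b
    ... | inj₁ refl = classify-1-1 c hw
    ... | inj₂ (i , yb) with X-one (blocked-second i (num zero) b c (hw i) yb)
    ...   | refl with Y-zero b yb
    ...     | inj₁ refl = classify-1-2 c hw
    ...     | inj₂ refl = classify-1-1ˉ c hw

    classify-Y : ∀ i a b c → isY i a ≡ true → Blocked a b c → HW3 a b c
    classify-Y i a b c ya hw with blocked-first i a b c (hw i) ya
    ... | xb , yc with yLetter i a ya | xLetter i b xb | yLetter i c yc
    classify-Y zero _ _ _ _ hw | _ | ynum refl | xnum | ynum refl = hw-2-1-2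
    classify-Y zero _ _ _ _ hw | _ | ynum refl | xnum | ybar = hw-2-1-1ˉ
    classify-Y (suc i) (num k) _ c _ hw | _ | ynum ea | xnum | _
      with xLetter (inject₁ i) (num k) (blocked-second (inject₁ i) _ _ c (hw (inject₁ i)) (isY-num (inject₁ i) (next-inject₁ i)))
    ... | xnum = ⊥-elim (next-cycle (next-inject₁ i) ea)
    classify-Y i _ _ _ _ hw | _ | ynum ea | xbar eb | c-view with trans (sym ea) eb
    classify-Y i _ _ _ _ hw | _ | ynum ea | xbar eb | ynum ec | refl with trans (sym ea) ec
    ... | refl = hw-s-sˉ-s {t = i} ea
    classify-Y i _ _ _ _ hw | _ | ynum ea | xbar eb | ybar | refl = hw-s-sˉ-tˉ ea
    classify-Y i _ _ _ _ hw | _ | ybar | xnum | ynum ec = hw-jˉ-j-k ec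
    classify-Y i _ _ _ _ hw | _ | ybar | xnum | ybar = hw-jˉ-j-jˉ
    classify-Y i _ _ c _ hw | _ | ybar | xbar {k} eb | _
      with xLetter k (bar i) (blocked-second k _ _ c (hw k) (isY-bar k))
    ... | xbar e = ⊥-elim (next-cycle eb e)

  classify : ∀ a b c → HighestWeight (a ∷ b ∷ c ∷ []) → HW3 a b c
  classify a b c hw with one-or-Y a
  ... | inj₁ refl = classify-1 b c hw
  ... | inj₂ (i , ya) = classify-Y i a b c ya hw

Pointwise-map : ∀ {A B : Set} {R S : A → B → Set} → (∀ {a b} → R a b → S a b) →
  ∀ {m m′} → Pointwise R m m′ → Pointwise S m m′
Pointwise-map f (Pointwise.just r) = Pointwise.just (f r)
Pointwise-map f Pointwise.nothing = Pointwise.nothing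

record SameData {n} (y y′ : Word n) : Set where
  constructor sameData
  field
    wt≡ : wt y ≡ wt y′
    ε̈≡ : (i : Fin n) → ε̈ i y ≡ ε̈ i y′
    φ̈≡ : (i : Fin n) → φ̈ i y ≡ φ̈ i y′

Indistinguishable : ∀ {n} → Word n → Word n → Set
Indistinguishable {n} x x′ = (is : List (Fin n)) → Pointwise SameData (f̈⋆ is x) (f̈⋆ is x′)

Indistinguishable⇒SameData : ∀ {n} {x x′ : Word n} → Indistinguishable x x′ → SameData x x′
Indistinguishable⇒SameData same = Pointwise.drop-just (same [])

SameData-sym : ∀ {n} {y y′ : Word n} → SameData y y′ → SameData y′ y
SameData-sym (sameData wt≡ ε̈≡ φ̈≡) = sameData (sym wt≡) (sym ∘ ε̈≡) (sym ∘ φ̈≡)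

Indistinguishable-sym : ∀ {n} {x x′ : Word n} → Indistinguishable x x′ → Indistinguishable x′ x
Indistinguishable-sym same is = Pointwise.sym SameData-sym (same is)

module _ {n} {u v : Word n} (iso : u ≈h v) where
  open Correspondence iso

  ↦-Indistinguishable : ∀ {x x′} → x ↦ x′ → Indistinguishable x x′
  ↦-Indistinguishable x↦x′ is =
    Pointwise-map (λ y↦y′ → sameData (↦-wt y↦y′) (λ i → ↦-ε̈ i y↦y′) (λ i → ↦-φ̈ i y↦y′)) (↦-f̈⋆ is x↦x′)

Observation : Set
Observation = List ℤ × List ℕ∞ × List ℕ∞

record Probe (n : ℕ) : Set where
  field
    weights : List (Fin n)
    indices : List (Fin n)
    paths : List (List (Fin n))

  observe : Word n → Observation
  observe y = map (lookup (wt y)) weights , map (λ i → ε̈ i y) indices , map (λ i → φ̈ i y) indices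

  run : Word n → List (Maybe Observation)
  run x = map (λ is → Maybe.map observe (f̈⋆ is x)) paths

  observe-SameData : ∀ {m m′} → Pointwise SameData m m′ → Maybe.map observe m ≡ Maybe.map observe m′
  observe-SameData (Pointwise.just (sameData wt≡ ε̈≡ φ̈≡)) =
    cong just (cong₂ _,_ (cong (λ v → map (lookup v) weights) wt≡)
                         (cong₂ _,_ (map-cong ε̈≡ indices) (map-cong φ̈≡ indices)))
  observe-SameData Pointwise.nothing = refl

  run-Indistinguishable : ∀ {x x′} → Indistinguishable x x′ → run x ≡ run x′
  run-Indistinguishable same = map-cong (λ is → observe-SameData (same is)) paths

_≟ₗ_ : ∀ {n} → DecidableEquality (Letter n)
num i ≟ₗ num j = Dec.map′ (cong num) (λ { refl → refl }) (i ≟ j)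
num i ≟ₗ bar j = no λ ()
bar i ≟ₗ num j = no λ ()
bar i ≟ₗ bar j = Dec.map′ (cong bar) (λ { refl → refl }) (i ≟ j)

_≟ʷ_ : ∀ {n} → DecidableEquality (Word n)
_≟ʷ_ = List.≡-dec _≟ₗ_

_≟∞_ : DecidableEquality ℕ∞
fin k ≟∞ fin l = Dec.map′ (cong fin) (λ { refl → refl }) (k ℕ.≟ l)
fin k ≟∞ ∞ = no λ ()
∞ ≟∞ fin l = no λ ()
∞ ≟∞ ∞ = yes refl

_≟ᵒ_ : DecidableEquality (List (Maybe Observation))
_≟ᵒ_ = List.≡-dec (Maybe.≡-dec (Σ.≡-dec (List.≡-dec ℤ._≟_) (Σ.≡-dec (List.≡-dec _≟∞_) (List.≡-dec _≟∞_))))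

module Membership {n} = Data.List.Membership.DecPropositional (_≟ʷ_ {n})

∈-by-decision : ∀ {n} {w : Word n} {L} {decided : True (w Membership.∈? L)} → w ∈ L
∈-by-decision {decided = decided} = toWitness decided

module _ {m : ℕ} where

  private
    N : ℕ
    N = suc (suc m)

  -- Similar with the letter a drawn from w itself, which makes it decidable.
  Similar′ : Word N → Word N → Set
  Similar′ w w′ = (w ≡ w′) ⊎ Any (λ a → (w ∈ special 2≤N a) × (w′ ∈ special 2≤N a)) w

  similar′? : ∀ w w′ → Dec (Similar′ w w′)
  similar′? w w′ =
    (w ≟ʷ w′) ⊎-dec any? (λ a → (w Membership.∈? special 2≤N a) ×-dec (w′ Membership.∈? special 2≤N a)) w

  Similar′⇒Similar : ∀ {w w′} → Similar′ w w′ → Similar w w′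
  Similar′⇒Similar (inj₁ e) = inj₁ e
  Similar′⇒Similar (inj₂ any) = inj₂ (satisfied any)

Separates : ∀ {n} → Probe n → List (Word n) → (Word n → Word n → Set) → Set
Separates P L R = All (λ w → All (λ w′ → Probe.run P w ≡ Probe.run P w′ → R w w′) L) L

separates? : ∀ {n} (P : Probe n) L {R : Word n → Word n → Set} → (∀ w w′ → Dec (R w w′)) → Dec (Separates P L R)
separates? P L R? = all? (λ w → all? (λ w′ → (Probe.run P w ≟ᵒ Probe.run P w′) →-dec R? w w′) L) L

separates-Indistinguishable : ∀ {n} (P : Probe n) {L R} → Separates P L R → ∀ {w w′} → w ∈ L → w′ ∈ L →
  Indistinguishable w w′ → R w w′
separates-Indistinguishable P sep w∈ w′∈ same = All.lookup (All.lookup sep w∈) w′∈ (Probe.run-Indistinguishable P same)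

module TwoLetters where

  private
    𝟏 𝟐 𝟏ˉ 𝟐ˉ : Letter 2
    𝟏 = num zero
    𝟐 = num (suc zero)
    𝟏ˉ = bar zero
    𝟐ˉ = bar (suc zero)

  highestWeightWords : List (Word 2)
  highestWeightWords =
    (𝟏 ∷ 𝟏 ∷ 𝟏 ∷ []) ∷ (𝟏 ∷ 𝟏 ∷ 𝟐 ∷ []) ∷ (𝟏 ∷ 𝟏 ∷ 𝟏ˉ ∷ []) ∷ (𝟏 ∷ 𝟐 ∷ 𝟏 ∷ []) ∷ (𝟏 ∷ 𝟐 ∷ 𝟐 ∷ []) ∷
    (𝟏 ∷ 𝟐 ∷ 𝟏ˉ ∷ []) ∷ (𝟏 ∷ 𝟐 ∷ 𝟐ˉ ∷ []) ∷ (𝟏 ∷ 𝟏ˉ ∷ 𝟏 ∷ []) ∷ (𝟏 ∷ 𝟏ˉ ∷ 𝟐 ∷ []) ∷ (𝟏 ∷ 𝟏ˉ ∷ 𝟏ˉ ∷ []) ∷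
    (𝟐 ∷ 𝟏 ∷ 𝟐 ∷ []) ∷ (𝟐 ∷ 𝟏 ∷ 𝟏ˉ ∷ []) ∷ (𝟐 ∷ 𝟐ˉ ∷ 𝟐 ∷ []) ∷ (𝟐 ∷ 𝟐ˉ ∷ 𝟏ˉ ∷ []) ∷ (𝟏ˉ ∷ 𝟏 ∷ 𝟐 ∷ []) ∷
    (𝟏ˉ ∷ 𝟏 ∷ 𝟏ˉ ∷ []) ∷ (𝟐ˉ ∷ 𝟐 ∷ 𝟐ˉ ∷ []) ∷ []

  HW3-∈ : ∀ {a b c} → HW3 a b c → (a ∷ b ∷ c ∷ []) ∈ highestWeightWords
  HW3-∈ hw-1-1-1 = ∈-by-decision
  HW3-∈ hw-1-1-2 = ∈-by-decision
  HW3-∈ hw-1-1-1ˉ = ∈-by-decision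
  HW3-∈ hw-1-2-1 = ∈-by-decision
  HW3-∈ hw-1-2-2 = ∈-by-decision
  HW3-∈ (hw-1-2-3 ())
  HW3-∈ hw-1-2-1ˉ = ∈-by-decision
  HW3-∈ hw-1-2-2ˉ = ∈-by-decision
  HW3-∈ hw-1-1ˉ-1 = ∈-by-decision
  HW3-∈ hw-1-1ˉ-2 = ∈-by-decision
  HW3-∈ hw-1-1ˉ-1ˉ = ∈-by-decision
  HW3-∈ hw-2-1-2 = ∈-by-decision
  HW3-∈ hw-2-1-1ˉ = ∈-by-decision
  HW3-∈ (hw-s-sˉ-s {zero} refl) = ∈-by-decision
  HW3-∈ (hw-s-sˉ-s {suc zero} ())
  HW3-∈ (hw-s-sˉ-tˉ {zero} refl) = ∈-by-decision
  HW3-∈ (hw-s-sˉ-tˉ {suc zero} ())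
  HW3-∈ (hw-jˉ-j-k {zero} refl) = ∈-by-decision
  HW3-∈ (hw-jˉ-j-k {suc zero} ())
  HW3-∈ (hw-jˉ-j-jˉ {zero}) = ∈-by-decision
  HW3-∈ (hw-jˉ-j-jˉ {suc zero}) = ∈-by-decision

  probe : Probe 2
  probe = record
    { weights = zero ∷ suc zero ∷ []
    ; indices = zero ∷ suc zero ∷ []
    ; paths = [] ∷ (suc zero ∷ []) ∷ (suc zero ∷ zero ∷ zero ∷ []) ∷ (suc zero ∷ suc zero ∷ zero ∷ []) ∷ []
    }

  -- opaque, so that checking its uses does not re-run the decision procedure.
  opaque
    separates : Separates probe highestWeightWords Similar′
    separates = toWitness {a? = separates? probe highestWeightWords similar′?} tt

  separate : ∀ {a b c a′ b′ c′} → Indistinguishable (a ∷ b ∷ c ∷ []) (a′ ∷ b′ ∷ c′ ∷ []) →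
    HW3 a b c → HW3 a′ b′ c′ → Similar (a ∷ b ∷ c ∷ []) (a′ ∷ b′ ∷ c′ ∷ [])
  separate same hw hw′ = Similar′⇒Similar (separates-Indistinguishable probe separates (HW3-∈ hw) (HW3-∈ hw′) same)

f̈Letter⋆ : ∀ {n} → List (Fin n) → Letter n → Maybe (Letter n)
f̈Letter⋆ [] c = just c
f̈Letter⋆ (i ∷ is) c = f̈Letter i c Maybe.>>= f̈Letter⋆ is

f̈Letter⋆-++ : ∀ {n} (is js : List (Fin n)) c → f̈Letter⋆ (is ++ js) c ≡ (f̈Letter⋆ is c Maybe.>>= f̈Letter⋆ js)
f̈Letter⋆-++ [] js c = refl
f̈Letter⋆-++ (i ∷ is) js c with f̈Letter i c
... | just c′ = f̈Letter⋆-++ is js c′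
... | nothing = refl

lift : ∀ {n} → Letter n → Letter (suc n)
lift (num j) = num (suc j)
lift (bar j) = bar (suc j)

≟-suc : ∀ {n} (i j : Fin n) → ⌊ suc i ≟ suc j ⌋ ≡ ⌊ i ≟ j ⌋
≟-suc i j = ⌊⌋-map′ (cong suc) Fin.suc-injective (i ≟ j)

isX-lift : ∀ {n} (i : Fin (suc n)) c → isX (suc i) (lift c) ≡ isX i c
isX-lift i (num j) = ≟-suc j i
isX-lift i (bar j) with next i
... | just k = ≟-suc j k
... | nothing = refl

fImg-lift : ∀ {n} (i : Fin (suc n)) c → fImg (suc i) (lift c) ≡ lift (fImg i c)
fImg-lift i (num j) with next i
... | just k = refl
... | nothing = refl
fImg-lift i (bar j) = refl

f̈Letter⋆-lift : ∀ {n} (is : List (Fin (suc n))) c → f̈Letter⋆ (map suc is) (lift c) ≡ Maybe.map lift (f̈Letter⋆ is c)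
f̈Letter⋆-lift [] c = refl
f̈Letter⋆-lift (i ∷ is) c rewrite isX-lift i c with isX i c
... | true rewrite fImg-lift i c = f̈Letter⋆-lift is (fImg i c)
... | false = refl

-- f̈ along the indices 1, 2, …, n, …, 2, 1 carries 1 through n and n̄ to 1̄.
num-to-bar : ∀ n → Σ[ is ∈ List (Fin (suc n)) ] f̈Letter⋆ is (num zero) ≡ just (bar zero)
num-to-bar zero = zero ∷ [] , refl
num-to-bar (suc n) with num-to-bar n
... | is , climb = zero ∷ map suc is ++ zero ∷ [] , (begin
  f̈Letter⋆ (map suc is ++ zero ∷ []) (lift (num zero))                       ≡⟨ f̈Letter⋆-++ (map suc is) (zero ∷ []) _ ⟩
  (f̈Letter⋆ (map suc is) (lift (num zero)) Maybe.>>= f̈Letter⋆ (zero ∷ []))  ≡⟨ cong (Maybe._>>= f̈Letter⋆ (zero ∷ [])) (f̈Letter⋆-lift is (num zero)) ⟩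
  (Maybe.map lift (f̈Letter⋆ is (num zero)) Maybe.>>= f̈Letter⋆ (zero ∷ []))  ≡⟨ cong (λ r → Maybe.map lift r Maybe.>>= f̈Letter⋆ (zero ∷ [])) climb ⟩
  just (bar zero)                                                             ∎)
  where open ≡-Reasoning

f̈⋆-++ : ∀ {n} (is js : List (Fin n)) w → f̈⋆ (is ++ js) w ≡ (f̈⋆ is w Maybe.>>= f̈⋆ js)
f̈⋆-++ [] js w = refl
f̈⋆-++ (i ∷ is) js w with f̈ i w
... | just w′ = f̈⋆-++ is js w′
... | nothing = refl

f̈⋆-lone : ∀ {n k} (ι : Fin k → Fin n) pre suf → (∀ j → Neutral (ι j) pre) → (∀ j → Neutral (ι j) suf) →
  ∀ is c → f̈⋆ (map ι is) (pre ++ c ∷ suf) ≡ Maybe.map (λ b → pre ++ b ∷ suf) (f̈Letter⋆ (map ι is) c)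
f̈⋆-lone ι pre suf neutral-pre neutral-suf [] c = refl
f̈⋆-lone ι pre suf neutral-pre neutral-suf (j ∷ is) c
  rewrite f̈-lone (ι j) pre suf (neutral-pre j) (neutral-suf j) c with f̈Letter (ι j) c
... | just c′ = f̈⋆-lone ι pre suf neutral-pre neutral-suf is c′
... | nothing = refl

-- Highest weight words of weight ±e_r

isX-bar-pred : ∀ {n} {j r : Fin n} → next j ≡ just r → isX r (bar j) ≡ false
isX-bar-pred {j = j} {r} e = ¬-not λ x → lemma (xLetter r (bar j) x)
  where
  lemma : XLetter r (bar j) → ⊥
  lemma (xbar e′) = next-cycle e e′

ε̈-inversion : ∀ {n} (i : Fin n) w → hasInv i w ≡ true → ε̈ i w ≡ ∞
ε̈-inversion i w inv rewrite inv = refl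

ε̈-finite : ∀ {n} (i : Fin n) w → hasInv i w ≡ false → ε̈ i w ≢ ∞
ε̈-finite i w noInv rewrite noInv = λ ()

module _ {m : ℕ} where

  private
    N : ℕ
    N = suc (suc m)

  -- The members of HW3 whose weight ±e_r has r ≥ 3 in the paper's numbering; the others are
  -- finitely many words over 1, 2, 3 and their bars.
  data Generic : Word N → Set where
    generic-s-sˉ-s  : ∀ {t s} → next t ≡ just s → 2 ≤ toℕ s → Generic (num s ∷ bar s ∷ num s ∷ [])
    generic-jˉ-j-k  : ∀ {j k} → next j ≡ just k → 2 ≤ toℕ k → Generic (bar j ∷ num j ∷ num k ∷ [])
    generic-s-sˉ-tˉ : ∀ {t s} → next t ≡ just s → 2 ≤ toℕ t → Generic (num s ∷ bar s ∷ bar t ∷ [])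
    generic-jˉ-j-jˉ : ∀ {j} → 2 ≤ toℕ j → Generic (bar j ∷ num j ∷ bar j ∷ [])

  centre : ∀ {w} → Generic w → Fin N
  centre (generic-s-sˉ-s {s = s} _ _) = s
  centre (generic-jˉ-j-k {k = k} _ _) = k
  centre (generic-s-sˉ-tˉ {t = t} _ _) = t
  centre (generic-jˉ-j-jˉ {j} _) = j

  centre-≥2 : ∀ {w} (g : Generic w) → 2 ≤ toℕ (centre g)
  centre-≥2 (generic-s-sˉ-s _ 2≤s) = 2≤s
  centre-≥2 (generic-jˉ-j-k _ 2≤k) = 2≤k
  centre-≥2 (generic-s-sˉ-tˉ _ 2≤t) = 2≤t
  centre-≥2 (generic-jˉ-j-jˉ 2≤j) = 2≤j

  unit : ∀ {w} → Generic w → ℤ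
  unit (generic-s-sˉ-s _ _) = + 1
  unit (generic-jˉ-j-k _ _) = + 1
  unit (generic-s-sˉ-tˉ _ _) = -[1+ 0 ]
  unit (generic-jˉ-j-jˉ _) = -[1+ 0 ]

  wt-Generic : ∀ {w} (g : Generic w) p → lookup (wt w) p ≡ (if ⌊ centre g ≟ p ⌋ then unit g else + 0)
  wt-Generic {w} g p = trans (lookup∘tabulate (λ j → + count (eqL j) w - + count (eqB j) w) p) (counts g)
    where
    counts : ∀ {w} (g : Generic w) → + count (eqL p) w - + count (eqB p) w ≡ (if ⌊ centre g ≟ p ⌋ then unit g else + 0)
    counts (generic-s-sˉ-s {s = s} _ _) with s ≟ p
    ... | yes _ = refl
    ... | no _ = refl
    counts (generic-jˉ-j-k {j} {k} e _) with j ≟ p | k ≟ p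
    ... | yes refl | yes refl = ⊥-elim (next-≢ e refl)
    ... | yes _ | no _ = refl
    ... | no _ | yes _ = refl
    ... | no _ | no _ = refl
    counts (generic-s-sˉ-tˉ {t} {s} e _) with s ≟ p | t ≟ p
    ... | yes refl | yes refl = ⊥-elim (next-≢ e refl)
    ... | yes _ | no _ = refl
    ... | no _ | yes _ = refl
    ... | no _ | no _ = refl
    counts (generic-jˉ-j-jˉ {j} _) with j ≟ p
    ... | yes _ = refl
    ... | no _ = refl

  unit-nonzero : ∀ {w} (g : Generic w) → unit g ≢ + 0
  unit-nonzero (generic-s-sˉ-s _ _) ()
  unit-nonzero (generic-jˉ-j-k _ _) ()
  unit-nonzero (generic-s-sˉ-tˉ _ _) ()
  unit-nonzero (generic-jˉ-j-jˉ _) ()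

  wt-at-centre : ∀ {w} (g : Generic w) → lookup (wt w) (centre g) ≡ unit g
  wt-at-centre g = trans (wt-Generic g (centre g)) (cong (λ b → if b then unit g else + 0) (≟-diag (centre g)))

  Generic-centre : ∀ {w w′} (g : Generic w) (g′ : Generic w′) → wt w ≡ wt w′ →
    (centre g ≡ centre g′) × (unit g ≡ unit g′)
  Generic-centre {w′ = w′} g g′ wt≡ = compare (trans (sym (wt-at-centre g)) (cong (λ v → lookup v (centre g)) wt≡))
    where
    compare : unit g ≡ lookup (wt w′) (centre g) → (centre g ≡ centre g′) × (unit g ≡ unit g′)
    compare e with centre g′ ≟ centre g | wt-Generic g′ (centre g)
    ... | yes c≡ | at = sym c≡ , trans e at
    ... | no _ | at = ⊥-elim (unit-nonzero g (trans e at))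

  ε̈-s-sˉ : ∀ (s : Fin N) c → ε̈ s (num s ∷ bar s ∷ c ∷ []) ≡ ∞
  ε̈-s-sˉ s c = ε̈-inversion s (num s ∷ bar s ∷ c ∷ [])
    (hasInv-witness s [] {num s} (bar s ∷ c ∷ []) (isX-num s) (anyL-mid (isY s) [] {bar s} (c ∷ []) (isY-bar s)))

  ε̈-jˉ-j-k : ∀ {j k : Fin N} → next j ≡ just k → ε̈ k (bar j ∷ num j ∷ num k ∷ []) ≢ ∞
  ε̈-jˉ-j-k {j} {k} e = ε̈-finite k (bar j ∷ num j ∷ num k ∷ [])
    (hasInv-mid k (bar j ∷ num j ∷ []) (num k) [] (cong₂ _∨_ (isX-bar-pred e) (cong (_∨ false) (≟-≢ (next-≢ e)))) refl)

  ε̈-jˉ-j-jˉ : ∀ {j s : Fin N} → next j ≡ just s → ε̈ s (bar j ∷ num j ∷ bar j ∷ []) ≢ ∞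
  ε̈-jˉ-j-jˉ {j} {s} e = ε̈-finite s (bar j ∷ num j ∷ bar j ∷ [])
    (hasInv-mid s (bar j ∷ num j ∷ []) (bar j) [] (cong₂ _∨_ (isX-bar-pred e) (cong (_∨ false) (≟-≢ (next-≢ e)))) refl)

  Generic-separate : ∀ {w w′} → Generic w → Generic w′ → wt w ≡ wt w′ → (∀ i → ε̈ i w ≡ ε̈ i w′) → w ≡ w′
  Generic-separate g g′ wt≡ ε̈≡ with Generic-centre g g′ wt≡
  Generic-separate (generic-s-sˉ-s _ _) (generic-s-sˉ-s _ _) _ _ | refl , _ = refl
  Generic-separate (generic-s-sˉ-s {s = s} _ _) (generic-jˉ-j-k {j} e _) _ ε̈≡ | refl , _ =
    ⊥-elim (ε̈-jˉ-j-k {j} e (trans (sym (ε̈≡ s)) (ε̈-s-sˉ s (num s))))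
  Generic-separate (generic-jˉ-j-k {j} e _) (generic-s-sˉ-s {s = s} _ _) _ ε̈≡ | refl , _ =
    ⊥-elim (ε̈-jˉ-j-k {j} e (trans (ε̈≡ s) (ε̈-s-sˉ s (num s))))
  Generic-separate (generic-jˉ-j-k {j} e _) (generic-jˉ-j-k {j′} e′ _) _ _ | refl , _ with next-injective {i = j} {j′} e e′
  ... | refl = refl
  Generic-separate (generic-s-sˉ-tˉ e _) (generic-s-sˉ-tˉ e′ _) _ _ | refl , _ with trans (sym e) e′
  ... | refl = refl
  Generic-separate (generic-s-sˉ-tˉ {t} {s} e _) (generic-jˉ-j-jˉ _) _ ε̈≡ | refl , _ =
    ⊥-elim (ε̈-jˉ-j-jˉ {t} e (trans (sym (ε̈≡ s)) (ε̈-s-sˉ s (bar t))))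
  Generic-separate (generic-jˉ-j-jˉ _) (generic-s-sˉ-tˉ {t} {s} e _) _ ε̈≡ | refl , _ =
    ⊥-elim (ε̈-jˉ-j-jˉ {t} e (trans (ε̈≡ s) (ε̈-s-sˉ s (bar t))))
  Generic-separate (generic-jˉ-j-jˉ _) (generic-jˉ-j-jˉ _) _ _ | refl , _ = refl
  Generic-separate (generic-s-sˉ-s _ _) (generic-s-sˉ-tˉ _ _) _ _ | _ , ()
  Generic-separate (generic-s-sˉ-s _ _) (generic-jˉ-j-jˉ _) _ _ | _ , ()
  Generic-separate (generic-jˉ-j-k _ _) (generic-s-sˉ-tˉ _ _) _ _ | _ , ()
  Generic-separate (generic-jˉ-j-k _ _) (generic-jˉ-j-jˉ _) _ _ | _ , ()
  Generic-separate (generic-s-sˉ-tˉ _ _) (generic-s-sˉ-s _ _) _ _ | _ , ()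
  Generic-separate (generic-s-sˉ-tˉ _ _) (generic-jˉ-j-k _ _) _ _ | _ , ()
  Generic-separate (generic-jˉ-j-jˉ _) (generic-s-sˉ-s _ _) _ _ | _ , ()
  Generic-separate (generic-jˉ-j-jˉ _) (generic-jˉ-j-k _ _) _ _ | _ , ()

-- At least three letters

module ThreeOrMore {m′ : ℕ} where

  private
    N : ℕ
    N = suc (suc (suc m′))

    𝟏 𝟐 𝟑 𝟏ˉ 𝟐ˉ 𝟑ˉ : Letter N
    𝟏 = num zero
    𝟐 = num (suc zero)
    𝟑 = num (suc (suc zero))
    𝟏ˉ = bar zero
    𝟐ˉ = bar (suc zero)
    𝟑ˉ = bar (suc (suc zero))

  smallWords : List (Word N)
  smallWords =
    (𝟏 ∷ 𝟏 ∷ 𝟏 ∷ []) ∷ (𝟏 ∷ 𝟏 ∷ 𝟐 ∷ []) ∷ (𝟏 ∷ 𝟏 ∷ 𝟏ˉ ∷ []) ∷ (𝟏 ∷ 𝟐 ∷ 𝟏 ∷ []) ∷ (𝟏 ∷ 𝟐 ∷ 𝟐 ∷ []) ∷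
    (𝟏 ∷ 𝟐 ∷ 𝟑 ∷ []) ∷ (𝟏 ∷ 𝟐 ∷ 𝟏ˉ ∷ []) ∷ (𝟏 ∷ 𝟐 ∷ 𝟐ˉ ∷ []) ∷ (𝟏 ∷ 𝟏ˉ ∷ 𝟏 ∷ []) ∷ (𝟏 ∷ 𝟏ˉ ∷ 𝟐 ∷ []) ∷
    (𝟏 ∷ 𝟏ˉ ∷ 𝟏ˉ ∷ []) ∷ (𝟐 ∷ 𝟏 ∷ 𝟐 ∷ []) ∷ (𝟐 ∷ 𝟏 ∷ 𝟏ˉ ∷ []) ∷ (𝟐 ∷ 𝟐ˉ ∷ 𝟐 ∷ []) ∷ (𝟐 ∷ 𝟐ˉ ∷ 𝟏ˉ ∷ []) ∷
    (𝟑 ∷ 𝟑ˉ ∷ 𝟐ˉ ∷ []) ∷ (𝟏ˉ ∷ 𝟏 ∷ 𝟐 ∷ []) ∷ (𝟏ˉ ∷ 𝟏 ∷ 𝟏ˉ ∷ []) ∷ (𝟐ˉ ∷ 𝟐 ∷ 𝟐ˉ ∷ []) ∷ []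

  HW3-small-or-generic : ∀ {a b c} → HW3 a b c → ((a ∷ b ∷ c ∷ []) ∈ smallWords) ⊎ Generic (a ∷ b ∷ c ∷ [])
  HW3-small-or-generic hw-1-1-1 = inj₁ ∈-by-decision
  HW3-small-or-generic hw-1-1-2 = inj₁ ∈-by-decision
  HW3-small-or-generic hw-1-1-1ˉ = inj₁ ∈-by-decision
  HW3-small-or-generic hw-1-2-1 = inj₁ ∈-by-decision
  HW3-small-or-generic hw-1-2-2 = inj₁ ∈-by-decision
  HW3-small-or-generic (hw-1-2-3 refl) = inj₁ ∈-by-decision
  HW3-small-or-generic hw-1-2-1ˉ = inj₁ ∈-by-decision
  HW3-small-or-generic hw-1-2-2ˉ = inj₁ ∈-by-decision
  HW3-small-or-generic hw-1-1ˉ-1 = inj₁ ∈-by-decision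
  HW3-small-or-generic hw-1-1ˉ-2 = inj₁ ∈-by-decision
  HW3-small-or-generic hw-1-1ˉ-1ˉ = inj₁ ∈-by-decision
  HW3-small-or-generic hw-2-1-2 = inj₁ ∈-by-decision
  HW3-small-or-generic hw-2-1-1ˉ = inj₁ ∈-by-decision
  HW3-small-or-generic (hw-s-sˉ-s {zero} refl) = inj₁ ∈-by-decision
  HW3-small-or-generic (hw-s-sˉ-s {suc t} e) =
    inj₂ (generic-s-sˉ-s {t = suc t} e (subst (2 ≤_) (sym (toℕ-next (suc t) e)) (s≤s (s≤s z≤n))))
  HW3-small-or-generic (hw-s-sˉ-tˉ {zero} refl) = inj₁ ∈-by-decision
  HW3-small-or-generic (hw-s-sˉ-tˉ {suc zero} refl) = inj₁ ∈-by-decision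
  HW3-small-or-generic (hw-s-sˉ-tˉ {suc (suc t)} e) = inj₂ (generic-s-sˉ-tˉ e (s≤s (s≤s z≤n)))
  HW3-small-or-generic (hw-jˉ-j-k {zero} refl) = inj₁ ∈-by-decision
  HW3-small-or-generic (hw-jˉ-j-k {suc j} e) =
    inj₂ (generic-jˉ-j-k e (subst (2 ≤_) (sym (toℕ-next (suc j) e)) (s≤s (s≤s z≤n))))
  HW3-small-or-generic (hw-jˉ-j-jˉ {zero}) = inj₁ ∈-by-decision
  HW3-small-or-generic (hw-jˉ-j-jˉ {suc zero}) = inj₁ ∈-by-decision
  HW3-small-or-generic (hw-jˉ-j-jˉ {suc (suc j)}) = inj₂ (generic-jˉ-j-jˉ (s≤s (s≤s z≤n)))

  probe : Probe N
  probe = record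
    { weights = zero ∷ suc zero ∷ []
    ; indices = zero ∷ suc zero ∷ []
    ; paths = [] ∷ (suc zero ∷ []) ∷ []
    }

  -- The pairs of small words on which the probe agrees without their being similar.
  probeBlindPairs : List (Word N × Word N)
  probeBlindPairs =
    ((𝟏 ∷ 𝟏 ∷ 𝟐 ∷ []) , (𝟏 ∷ 𝟐 ∷ 𝟏 ∷ [])) ∷ ((𝟏 ∷ 𝟐 ∷ 𝟏 ∷ []) , (𝟏 ∷ 𝟏 ∷ 𝟐 ∷ [])) ∷
    ((𝟏 ∷ 𝟐 ∷ 𝟐 ∷ []) , (𝟐 ∷ 𝟏 ∷ 𝟐 ∷ [])) ∷ ((𝟐 ∷ 𝟏 ∷ 𝟐 ∷ []) , (𝟏 ∷ 𝟐 ∷ 𝟐 ∷ [])) ∷ []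

  SimilarOrBlind : Word N → Word N → Set
  SimilarOrBlind w w′ = Similar′ w w′ ⊎ (w , w′) ∈ probeBlindPairs

  opaque
    separates : Separates probe smallWords SimilarOrBlind
    separates =
      toWitness {a? = separates? probe smallWords λ w w′ → similar′? w w′ ⊎-dec ((w , w′) ∈?ₚ probeBlindPairs)} tt
      where open Data.List.Membership.DecPropositional (Σ.≡-dec _≟ʷ_ _≟ʷ_) using () renaming (_∈?_ to _∈?ₚ_)

  Balanced : Vec ℤ N → Set
  Balanced v = (lookup v zero ≡ + 0) × (lookup v (suc zero) ≡ + 0)

  smallWords-unbalanced : All (λ w → ¬ Balanced (wt w)) smallWords
  smallWords-unbalanced = toWitness {a? = all? (λ w → Dec.¬? (balanced? (wt w))) smallWords} tt
    where
    balanced? : ∀ v → Dec (Balanced v)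
    balanced? v = (lookup v zero ℤ.≟ + 0) ×-dec (lookup v (suc zero) ℤ.≟ + 0)

  Generic-balanced : ∀ {w} → Generic w → Balanced (wt w)
  Generic-balanced {w} g = away-from-centre zero (λ ()) , away-from-centre (suc zero) λ { (s≤s ()) }
    where
    away-from-centre : ∀ p → ¬ (2 ≤ toℕ p) → lookup (wt w) p ≡ + 0
    away-from-centre p small =
      trans (wt-Generic g p) (cong (λ b → if b then unit g else + 0) (≟-≢ λ { refl → small (centre-≥2 g) }))

  Low : Letter N → Set
  Low c = (c ≡ 𝟏) ⊎ (c ≡ 𝟐)

  Low-neutral : (j : Fin (suc m′)) {w : Word N} → All Low w → Neutral (suc (suc j)) w
  Low-neutral j All.[] = refl , refl
  Low-neutral j (low All.∷ lows) = cong₂ _∨_ (proj₁ (letter low)) (proj₁ (Low-neutral j lows))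
                             , cong₂ _∨_ (proj₂ (letter low)) (proj₂ (Low-neutral j lows))
    where
    letter : ∀ {c} → Low c → (isX (suc (suc j)) c ≡ false) × (isY (suc (suc j)) c ≡ false)
    letter (inj₁ refl) with next j
    ... | just _ = refl , refl
    ... | nothing = refl , refl
    letter (inj₂ refl) with next j
    ... | just _ = refl , refl
    ... | nothing = refl , refl

  raise₂ : Fin (suc m′) → Fin N
  raise₂ j = suc (suc j)

  climb : List (Fin N)
  climb = map raise₂ (proj₁ (num-to-bar m′))

  climb-letter : f̈Letter⋆ climb 𝟑 ≡ just 𝟑ˉ
  climb-letter = begin
    f̈Letter⋆ (map raise₂ is) 𝟑                              ≡⟨ cong (λ js → f̈Letter⋆ js 𝟑) (List.map-∘ is) ⟩
    f̈Letter⋆ (map suc (map suc is)) (lift (lift (num zero))) ≡⟨ f̈Letter⋆-lift (map suc is) (lift (num zero)) ⟩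
    Maybe.map lift (f̈Letter⋆ (map suc is) (lift (num zero))) ≡⟨ cong (Maybe.map lift) (f̈Letter⋆-lift is (num zero)) ⟩
    Maybe.map lift (Maybe.map lift (f̈Letter⋆ is (num zero))) ≡⟨ cong (Maybe.map lift ∘ Maybe.map lift) (proj₂ (num-to-bar m′)) ⟩
    just 𝟑ˉ                                                  ∎
    where
    open ≡-Reasoning
    is = proj₁ (num-to-bar m′)

  detour : ∀ {w} pre suf → All Low pre → All Low suf → f̈ (suc zero) w ≡ just (pre ++ 𝟑 ∷ suf) →
    ∀ tail → f̈⋆ (suc zero ∷ climb ++ tail) w ≡ f̈⋆ tail (pre ++ 𝟑ˉ ∷ suf)
  detour {w} pre suf low-pre low-suf entry tail = begin
    (f̈ (suc zero) w Maybe.>>= f̈⋆ (climb ++ tail))                      ≡⟨ cong (Maybe._>>= f̈⋆ (climb ++ tail)) entry ⟩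
    f̈⋆ (climb ++ tail) (pre ++ 𝟑 ∷ suf)                                ≡⟨ f̈⋆-++ climb tail _ ⟩
    (f̈⋆ climb (pre ++ 𝟑 ∷ suf) Maybe.>>= f̈⋆ tail)                      ≡⟨ cong (Maybe._>>= f̈⋆ tail) climb-word ⟩
    f̈⋆ tail (pre ++ 𝟑ˉ ∷ suf)                                          ∎
    where
    open ≡-Reasoning
    climb-word : f̈⋆ climb (pre ++ 𝟑 ∷ suf) ≡ just (pre ++ 𝟑ˉ ∷ suf)
    climb-word = trans (f̈⋆-lone raise₂ pre suf (λ j → Low-neutral j low-pre) (λ j → Low-neutral j low-suf) (proj₁ (num-to-bar m′)) 𝟑)
                       (cong (Maybe.map (λ b → pre ++ b ∷ suf)) climb-letter)

  -- f̈_2 turns a 2 into 3, climb carries it to 3̄, and the tail makes ε̈_2 infinite on one side only.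
  blind-112-121 : ¬ Indistinguishable (𝟏 ∷ 𝟏 ∷ 𝟐 ∷ []) (𝟏 ∷ 𝟐 ∷ 𝟏 ∷ [])
  blind-112-121 same =
    distinguished (subst₂ (Pointwise SameData)
      (detour {𝟏 ∷ 𝟏 ∷ 𝟐 ∷ []} (𝟏 ∷ 𝟏 ∷ []) [] (inj₁ refl All.∷ inj₁ refl All.∷ All.[]) All.[] refl tail)
      (detour {𝟏 ∷ 𝟐 ∷ 𝟏 ∷ []} (𝟏 ∷ []) (𝟏 ∷ []) (inj₁ refl All.∷ All.[]) (inj₁ refl All.∷ All.[]) refl tail)
      (same (suc zero ∷ climb ++ tail)))
    where
    tail = suc zero ∷ zero ∷ zero ∷ []
    distinguished : Pointwise SameData (f̈⋆ tail (𝟏 ∷ 𝟏 ∷ 𝟑ˉ ∷ [])) (f̈⋆ tail (𝟏 ∷ 𝟑ˉ ∷ 𝟏 ∷ [])) → ⊥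
    distinguished (Pointwise.just same) with SameData.ε̈≡ same (suc zero)
    ... | ()

  blind-122-212 : ¬ Indistinguishable (𝟏 ∷ 𝟐 ∷ 𝟐 ∷ []) (𝟐 ∷ 𝟏 ∷ 𝟐 ∷ [])
  blind-122-212 same =
    distinguished (subst₂ (Pointwise SameData)
      (detour {𝟏 ∷ 𝟐 ∷ 𝟐 ∷ []} (𝟏 ∷ []) (𝟐 ∷ []) (inj₁ refl All.∷ All.[]) (inj₂ refl All.∷ All.[]) refl tail)
      (detour {𝟐 ∷ 𝟏 ∷ 𝟐 ∷ []} [] (𝟏 ∷ 𝟐 ∷ []) All.[] (inj₁ refl All.∷ inj₂ refl All.∷ All.[]) refl tail)
      (same (suc zero ∷ climb ++ tail)))
    where
    tail = suc zero ∷ suc zero ∷ zero ∷ []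
    distinguished : Pointwise SameData (f̈⋆ tail (𝟏 ∷ 𝟑ˉ ∷ 𝟐 ∷ [])) (f̈⋆ tail (𝟑ˉ ∷ 𝟏 ∷ 𝟐 ∷ [])) → ⊥
    distinguished (Pointwise.just same) with SameData.ε̈≡ same (suc zero)
    ... | ()

  blind-pair : ∀ {w w′} → (w , w′) ∈ probeBlindPairs → ¬ Indistinguishable w w′
  blind-pair (here refl) = blind-112-121
  blind-pair (there (here refl)) = blind-112-121 ∘ Indistinguishable-sym
  blind-pair (there (there (here refl))) = blind-122-212
  blind-pair (there (there (there (here refl)))) = blind-122-212 ∘ Indistinguishable-sym


  small-separate : ∀ {w w′} → w ∈ smallWords → w′ ∈ smallWords → Indistinguishable w w′ → Similar w w′
  small-separate w∈ w′∈ same with separates-Indistinguishable probe separates w∈ w′∈ same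
  ... | inj₁ similar = Similar′⇒Similar similar
  ... | inj₂ blind = ⊥-elim (blind-pair blind same)

  separate : ∀ {a b c a′ b′ c′} → Indistinguishable (a ∷ b ∷ c ∷ []) (a′ ∷ b′ ∷ c′ ∷ []) →
    HW3 a b c → HW3 a′ b′ c′ → Similar (a ∷ b ∷ c ∷ []) (a′ ∷ b′ ∷ c′ ∷ [])
  separate same hw hw′ with HW3-small-or-generic hw | HW3-small-or-generic hw′ | Indistinguishable⇒SameData same
  ... | inj₁ w∈ | inj₁ w′∈ | _ = small-separate w∈ w′∈ same
  ... | inj₁ w∈ | inj₂ g′ | sameData wt≡ _ _ =
    ⊥-elim (All.lookup smallWords-unbalanced w∈ (subst Balanced (sym wt≡) (Generic-balanced g′)))
  ... | inj₂ g | inj₁ w′∈ | sameData wt≡ _ _ =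
    ⊥-elim (All.lookup smallWords-unbalanced w′∈ (subst Balanced wt≡ (Generic-balanced g)))
  ... | inj₂ g | inj₂ g′ | sameData wt≡ ε̈≡ _ = inj₁ (Generic-separate g g′ wt≡ ε̈≡)

separate-HW3 : ∀ {m} {a b c a′ b′ c′ : Letter (suc (suc m))} → Indistinguishable (a ∷ b ∷ c ∷ []) (a′ ∷ b′ ∷ c′ ∷ []) →
  HW3 a b c → HW3 a′ b′ c′ → Similar (a ∷ b ∷ c ∷ []) (a′ ∷ b′ ∷ c′ ∷ [])
separate-HW3 {zero} = TwoLetters.separate
separate-HW3 {suc m′} = ThreeOrMore.separate

HighestWeight-separate : ∀ {m} {h h′ : Word (suc (suc m))} → Indistinguishable h h′ →
  HighestWeight h → HighestWeight h′ → length h ≡ 3 → length h′ ≡ 3 → Similar h h′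
HighestWeight-separate {h = a ∷ b ∷ c ∷ []} {a′ ∷ b′ ∷ c′ ∷ []} same hw hw′ refl refl =
  separate-HW3 same (classify a b c hw) (classify a′ b′ c′ hw′)

≈h⇒Similar : ∀ {m} {x x′ : Word (suc (suc m))} → length x ≡ 3 → length x′ ≡ 3 → x ≈h x′ → Similar x x′
≈h⇒Similar {x = x} len len′ iso with descend x (<-wellFounded (rankSum x))
... | h , d , hw = Similar-descent iso u↦v d hw λ h↦h′ len-h′ →
  HighestWeight-separate (↦-Indistinguishable iso h↦h′) hw (↦-HighestWeight h↦h′ hw)
                         (trans (Descent-length d) len) (trans len-h′ len′)
  where open Correspondence iso

theorem9p29 : (n : ℕ) → (h : 2 ≤ n) → (x y z x' y' z' : Letter n) →
    ((x ∷ y ∷ z ∷ []) ≈h (x' ∷ y' ∷ z' ∷ []))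
    ⇔ (((x ∷ y ∷ z ∷ []) ≡ (x' ∷ y' ∷ z' ∷ []))
       ⊎ Σ (Letter n) (λ a → ((x ∷ y ∷ z ∷ []) ∈ special h a) × ((x' ∷ y' ∷ z' ∷ []) ∈ special h a)))
theorem9p29 (suc (suc m)) (s≤s (s≤s z≤n)) x y z x′ y′ z′ =
  mk⇔ (≈h⇒Similar refl refl) Similar⇒≈h
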